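{- Let $q$ be a prime power, $n\ge1$, $d\in\mathbb F_q$, $P=\sum_{i\ge0}a_i\theta^i\in\mathbb F_q[\theta]$ and $P_2=\mu_d(P)$, i.e. $P_2(\theta)=P(\theta+d)$. Let $W=W_1(d)$ be the infinite matrix with rows and columns indexed by $0,1,2,\dots$ and entries $W_{ij}=\binom ji d^{j-i}$ for $j\ge i$, $W_{ij}=0$ for $i>j$. Then $$\mathfrak M(P_2,n,T-d)=W\,\mathfrak M(P,n,T)\,W^{ -1},$$ where $\mathfrak M(P_2,n,T-d)$ denotes $\mathfrak M(P_2,n,T)$ with $T$ replaced by $T-d$, and $W^{ -1}=W_1(-d)$.
   Context: For a polynomial $F=\sum_{i\ge0}b_i\theta^i\in\mathbb F_q[\theta]$, $\mathfrak M(F,n,T)$ is the infinite matrix over $\mathbb F_q[T]$ with rows and columns indexed by $0,1,2,\dots$ and entries $\mathfrak M(F,n,T)_{i,j}=\sum_{l=0}^nT^{n-l}(-1)^l\binom nl b_{(i+1)q-(j+1)-l}$, where $b_s:=0$ for $s<0$ or $s>\deg F$. All products of infinite matrices involved have only finitely many nonzero terms in each entry, so they are well defined. -}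

module Defs where

open import Level using (Level; _⊔_)
open import Algebra.Bundles using (CommutativeRing)
open import Data.Nat as ℕ using (ℕ; zero; suc; _≤_; _≤?_; _∸_)
open import Data.Nat.Primality using (Prime)
open import Data.Nat.Combinatorics using (_C_)
open import Data.Fin using (Fin)
open import Data.List using (List; []; _∷_)
open import Data.Product using (Σ; ∃; _×_; _,_)
open import Relation.Nullary using (¬_; yes; no)
open import Relation.Binary.PropositionalEquality as ≡ using (_≡_)
open import Function.Bundles using (Inverse)

IsPrimePower : ℕ → Set
IsPrimePower q = Σ ℕ λ p → Σ ℕ λ k → Prime p × (1 ≤ k) × (q ≡ p ℕ.^ k)

module _ {c ℓ : Level} (R : CommutativeRing c ℓ) where
  open CommutativeRing R

  IsField : Set (c ⊔ ℓ)
  IsField = (¬ (1# ≈ 0#)) × (∀ x → ¬ (x ≈ 0#) → ∃ λ y → x * y ≈ 1#)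

  HasCard : ℕ → Set (c ⊔ ℓ)
  HasCard q = Inverse setoid (≡.setoid (Fin q))

module Ops {c ℓ : Level} (R : CommutativeRing c ℓ) where
  open CommutativeRing R

  fromℕ : ℕ → Carrier
  fromℕ zero = 0#
  fromℕ (suc n) = 1# + fromℕ n

  pow : Carrier → ℕ → Carrier
  pow x zero = 1#
  pow x (suc n) = x * pow x n

  sumTo : ℕ → (ℕ → Carrier) → Carrier
  sumTo zero f = f 0
  sumTo (suc n) f = sumTo n f + f (suc n)

  sumBelow : ℕ → (ℕ → Carrier) → Carrier
  sumBelow zero f = 0#
  sumBelow (suc N) f = sumBelow N f + f N

  -- Polynomials in θ over R: coefficient lists a₀ ∷ a₁ ∷ …
  PolyΘ : Set c
  PolyΘ = List Carrier

  coeffΘ : PolyΘ → ℕ → Carrier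
  coeffΘ [] s = 0#
  coeffΘ (a ∷ as) zero = a
  coeffΘ (a ∷ as) (suc s) = coeffΘ as s

  -- b_{u - v} as an integer index: 0 when u < v
  coeffΘ− : PolyΘ → ℕ → ℕ → Carrier
  coeffΘ− F u v with v ≤? u
  ... | yes _ = coeffΘ F (u ∸ v)
  ... | no _ = 0#

  addΘ : PolyΘ → PolyΘ → PolyΘ
  addΘ [] g = g
  addΘ (a ∷ f) [] = a ∷ f
  addΘ (a ∷ f) (b ∷ g) = (a + b) ∷ addΘ f g

  scaleΘ : Carrier → PolyΘ → PolyΘ
  scaleΘ c [] = []
  scaleΘ c (a ∷ f) = (c * a) ∷ scaleΘ c f

  mulθ+d : Carrier → PolyΘ → PolyΘ
  mulθ+d d F = addΘ (0# ∷ F) (scaleΘ d F)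

  -- μ_d(P)(θ) = P(θ + d), by Horner: (a₀ + θ Q)(θ+d) = a₀ + (θ+d) Q(θ+d)
  μ : Carrier → PolyΘ → PolyΘ
  μ d [] = []
  μ d (a ∷ Q) = addΘ (a ∷ []) (mulθ+d d (μ d Q))

  PolyT : Set c
  PolyT = ℕ → Carrier

  _≈T_ : PolyT → PolyT → Set ℓ
  f ≈T g = ∀ e → f e ≈ g e

  constT : Carrier → PolyT
  constT a zero = a
  constT a (suc e) = 0#

  XT : PolyT
  XT zero = 0#
  XT (suc zero) = 1#
  XT (suc (suc e)) = 0#

  _+T_ : PolyT → PolyT → PolyT
  (f +T g) e = f e + g e

  _*T_ : PolyT → PolyT → PolyT
  (f *T g) e = sumTo e (λ a → f a * g (e ∸ a))

  powT : PolyT → ℕ → PolyT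
  powT f zero = constT 1#
  powT f (suc n) = f *T powT f n

  zeroT : PolyT
  zeroT e = 0#

  sumBelowT : ℕ → (ℕ → PolyT) → PolyT
  sumBelowT zero f = zeroT
  sumBelowT (suc N) f = sumBelowT N f +T f N

  sumToT : ℕ → (ℕ → PolyT) → PolyT
  sumToT zero f = f 0
  sumToT (suc n) f = sumToT n f +T f (suc n)

  MatT : Set c
  MatT = ℕ → ℕ → PolyT

  -- 𝔐(F, n, τ)_{ij} = Σ_{l=0}^{n} τ^{n-l} (-1)^l (n choose l) b_{(i+1)q-(j+1)-l},
  -- with the polynomial τ substituted for T (τ = T gives 𝔐(F,n,T)).
  𝔐 : ℕ → PolyΘ → ℕ → PolyT → MatT
  𝔐 q F n τ i j =
    sumToT n (λ l → powT τ (n ∸ l) *T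
      constT (pow (- 1#) l * (fromℕ (n C l)
               * coeffΘ− F (suc i ℕ.* q) (suc j ℕ.+ l))))

  W₁ : Carrier → ℕ → ℕ → Carrier
  W₁ d i j with i ≤? j
  ... | yes _ = fromℕ (j C i) * pow d (j ∸ i)
  ... | no _ = 0#

  -- partial sum (over k < N, m < N) of the entry (i,j) of A · M · B,
  -- for A, B matrices over R and M over R[T]
  triple≤ : ℕ → (ℕ → ℕ → Carrier) → MatT → (ℕ → ℕ → Carrier) → MatT
  triple≤ N A M B i j =
    sumBelowT N (λ k → sumBelowT N (λ m →
      constT (A i k) *T (M k m *T constT (B m j))))

-- Over R[T], the entry 𝔐(F, n, τ)ₖₘ is the coefficient of θ^((k+1)q-1) in θ^m (τ - θ)^n F(θ).
-- Summing against W₁(-d) over m replaces θ^m by (θ - d)^j, by the binomial theorem.  Summing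
-- against W₁(d) over k computes the same coefficient after the substitution θ ↦ θ + d: for a
-- monomial θ^w with w = b + a q in base q, the Frobenius identity (θ + d)^q = θ^q + d (R has
-- characteristic p and d^q = d) gives (θ + d)^w = (θ + d)^b (θ^q + d)^a, whose coefficient at
-- θ^((i+1)q-1) is (a choose i) d^(a-i) if b = q - 1 and 0 otherwise, which is exactly
-- Σₖ W₁(d)ᵢₖ [θ^((k+1)q-1)] θ^w.  The substitution turns (θ - d)^j (τ - θ)^n P(θ) into
-- θ^j ((τ - d) - θ)^n P₂(θ), whose coefficients are the entries of 𝔐(P₂, n, T - d).
module Submission where

open import Defs
open import Algebra.Bundles using (CommutativeRing)
open import Algebra.Structures using (IsCommutativeRing)
open import Data.Nat as ℕ using (ℕ; zero; suc; _≤_; _<_; _∸_; z≤n; s≤s; _≤?_; _<?_)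
import Data.Nat.Properties as ℕP
open import Data.Nat.Combinatorics using (_C_)
import Data.Nat.Combinatorics as ℕC
import Data.Nat.DivMod as ℕD
open import Data.Nat.Divisibility using (_∣_; divides)
import Data.Nat.Divisibility as ℕ∣
open import Data.Nat.Primality using (Prime; euclidsLemma; prime⇒nonZero)
open import Data.Fin as Fin using (Fin; toℕ)
import Data.Fin.Properties as FinP
open import Data.Fin.Permutation using (Permutation)
open import Data.List using ([]; _∷_; length)
open import Data.Product using (∃; _×_; _,_; proj₁; proj₂)
open import Data.Sum using (_⊎_; inj₁; inj₂)
open import Data.Empty using (⊥-elim)
open import Function using (_∘_)
open import Function.Bundles using (Inverse; mk↔ₛ′)
open import Relation.Nullary using (¬_; yes; no; Dec)
open import Relation.Nullary.Decidable using (map′)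
open import Relation.Binary.PropositionalEquality as ≡ using (_≡_; _≢_)

[1+k]*[1+n]C[1+k]≡[1+n]*nCk : ∀ n k → suc k ℕ.* (suc n C suc k) ≡ suc n ℕ.* (n C k)
[1+k]*[1+n]C[1+k]≡[1+n]*nCk zero zero = ≡.refl
[1+k]*[1+n]C[1+k]≡[1+n]*nCk zero (suc k)
  rewrite ℕC.k>n⇒nCk≡0 {1} {suc (suc k)} (s≤s (s≤s z≤n)) | ℕC.k>n⇒nCk≡0 {0} {suc k} (s≤s z≤n)
  = ℕP.*-zeroʳ (suc (suc k))
[1+k]*[1+n]C[1+k]≡[1+n]*nCk (suc n) k = begin
  suc k ℕ.* (suc (suc n) C suc k)
    ≡⟨ ≡.cong (suc k ℕ.*_) (≡.sym (ℕC.nCk+nC[k+1]≡[n+1]C[k+1] (suc n) k)) ⟩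
  suc k ℕ.* ((suc n C k) ℕ.+ (suc n C suc k))
    ≡⟨ ℕP.*-distribˡ-+ (suc k) (suc n C k) (suc n C suc k) ⟩
  suc k ℕ.* (suc n C k) ℕ.+ suc k ℕ.* (suc n C suc k)
    ≡⟨ ≡.cong (suc k ℕ.* (suc n C k) ℕ.+_) ([1+k]*[1+n]C[1+k]≡[1+n]*nCk n k) ⟩
  suc k ℕ.* (suc n C k) ℕ.+ suc n ℕ.* (n C k)
    ≡⟨ pascal k ⟩
  suc (suc n) ℕ.* (suc n C k) ∎
  where
  open ≡.≡-Reasoning
  pascal : ∀ k → suc k ℕ.* (suc n C k) ℕ.+ suc n ℕ.* (n C k) ≡ suc (suc n) ℕ.* (suc n C k)
  pascal zero = ≡.refl
  pascal (suc k) = begin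
    (suc n C suc k) ℕ.+ suc k ℕ.* (suc n C suc k) ℕ.+ suc n ℕ.* (n C suc k)
      ≡⟨ ≡.cong (λ z → (suc n C suc k) ℕ.+ z ℕ.+ suc n ℕ.* (n C suc k)) ([1+k]*[1+n]C[1+k]≡[1+n]*nCk n k) ⟩
    (suc n C suc k) ℕ.+ suc n ℕ.* (n C k) ℕ.+ suc n ℕ.* (n C suc k)
      ≡⟨ ℕP.+-assoc (suc n C suc k) (suc n ℕ.* (n C k)) (suc n ℕ.* (n C suc k)) ⟩
    (suc n C suc k) ℕ.+ (suc n ℕ.* (n C k) ℕ.+ suc n ℕ.* (n C suc k))
      ≡⟨ ≡.cong ((suc n C suc k) ℕ.+_) (≡.sym (ℕP.*-distribˡ-+ (suc n) (n C k) (n C suc k))) ⟩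
    (suc n C suc k) ℕ.+ suc n ℕ.* ((n C k) ℕ.+ (n C suc k))
      ≡⟨ ≡.cong (λ z → (suc n C suc k) ℕ.+ suc n ℕ.* z) (ℕC.nCk+nC[k+1]≡[n+1]C[k+1] n k) ⟩
    (suc n C suc k) ℕ.+ suc n ℕ.* (suc n C suc k) ∎

-- p divides k · (p C k) = p · ((p - 1) C (k - 1)) but not k.
p∣pCk : ∀ {p k} → Prime p → 0 < k → k < p → p ∣ p C k
p∣pCk {suc p-1} {suc k-1} p-prime _ k<p
  with euclidsLemma (suc k-1) (suc p-1 C suc k-1) p-prime
         (≡.subst (suc p-1 ∣_) (≡.sym ([1+k]*[1+n]C[1+k]≡[1+n]*nCk p-1 k-1)) (ℕ∣.m∣m*n (p-1 C k-1)))
... | inj₂ p∣pCk = p∣pCk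
... | inj₁ p∣k = ⊥-elim (ℕP.<⇒≱ k<p (ℕ∣.∣⇒≤ p∣k))

base-digits-injective : ∀ q x y u v → x < q → u < q → x ℕ.+ y ℕ.* q ≡ u ℕ.+ v ℕ.* q → x ≡ u × y ≡ v
base-digits-injective q@(suc _) x y u v x<q u<q eq = x≡u , y≡v
  where
  x≡u : x ≡ u
  x≡u = begin
    x                      ≡⟨ ℕD.m<n⇒m%n≡m x<q ⟨
    x ℕD.% q               ≡⟨ ℕD.[m+kn]%n≡m%n x y q ⟨
    (x ℕ.+ y ℕ.* q) ℕD.% q ≡⟨ ≡.cong (ℕD._% q) eq ⟩
    (u ℕ.+ v ℕ.* q) ℕD.% q ≡⟨ ℕD.[m+kn]%n≡m%n u v q ⟩
    u ℕD.% q               ≡⟨ ℕD.m<n⇒m%n≡m u<q ⟩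
    u                      ∎
    where open ≡.≡-Reasoning
  y≡v : y ≡ v
  y≡v = ℕP.*-cancelʳ-≡ y v q (ℕP.+-cancelˡ-≡ x _ _ (≡.trans eq (≡.cong (ℕ._+ v ℕ.* q) (≡.sym x≡u))))

module Sums {c ℓ} (K : CommutativeRing c ℓ) where
  open CommutativeRing K
  open Ops K
  open import Relation.Binary.Reasoning.Setoid setoid
  open import Algebra.Properties.CommutativeSemigroup +-commutativeSemigroup using (interchange)

  sumBelow-cong-< : ∀ N {f g : ℕ → Carrier} → (∀ k → k < N → f k ≈ g k) → sumBelow N f ≈ sumBelow N g
  sumBelow-cong-< zero eq = refl
  sumBelow-cong-< (suc N) eq =
    +-cong (sumBelow-cong-< N (λ k k<N → eq k (ℕP.m<n⇒m<1+n k<N))) (eq N ℕP.≤-refl)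

  sumBelow-cong : ∀ N {f g : ℕ → Carrier} → (∀ k → f k ≈ g k) → sumBelow N f ≈ sumBelow N g
  sumBelow-cong N eq = sumBelow-cong-< N (λ k _ → eq k)

  sumBelow-+ : ∀ N (f g : ℕ → Carrier) → sumBelow N (λ k → f k + g k) ≈ sumBelow N f + sumBelow N g
  sumBelow-+ zero f g = sym (+-identityˡ 0#)
  sumBelow-+ (suc N) f g = trans (+-congʳ (sumBelow-+ N f g)) (interchange _ _ _ _)

  *-distribˡ-sumBelow : ∀ N a (f : ℕ → Carrier) → a * sumBelow N f ≈ sumBelow N (λ k → a * f k)
  *-distribˡ-sumBelow zero a f = zeroʳ a
  *-distribˡ-sumBelow (suc N) a f = trans (distribˡ a _ _) (+-congʳ (*-distribˡ-sumBelow N a f))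

  *-distribʳ-sumBelow : ∀ N a (f : ℕ → Carrier) → sumBelow N f * a ≈ sumBelow N (λ k → f k * a)
  *-distribʳ-sumBelow N a f =
    trans (*-comm _ a) (trans (*-distribˡ-sumBelow N a f) (sumBelow-cong N (λ k → *-comm a (f k))))

  sumBelow-zero : ∀ N (f : ℕ → Carrier) → (∀ k → k < N → f k ≈ 0#) → sumBelow N f ≈ 0#
  sumBelow-zero zero f f≈0 = refl
  sumBelow-zero (suc N) f f≈0 =
    trans (+-cong (sumBelow-zero N f (λ k k<N → f≈0 k (ℕP.m<n⇒m<1+n k<N))) (f≈0 N ℕP.≤-refl)) (+-identityˡ 0#)

  sumBelow-single : ∀ N (f : ℕ → Carrier) k₀ → k₀ < N → (∀ k → k < N → k ≢ k₀ → f k ≈ 0#) →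
                    sumBelow N f ≈ f k₀
  sumBelow-single (suc N) f k₀ k₀<1+N f≈0 with N ℕP.≟ k₀
  ... | yes ≡.refl =
    trans (+-congʳ (sumBelow-zero N f (λ k k<N → f≈0 k (ℕP.m<n⇒m<1+n k<N) (λ k≡N → ℕP.<-irrefl k≡N k<N))))
          (+-identityˡ _)
  ... | no N≢k₀ =
    trans (+-cong (sumBelow-single N f k₀ (ℕP.≤∧≢⇒< (ℕP.≤-pred k₀<1+N) (N≢k₀ ∘ ≡.sym))
                                   (λ k k<N → f≈0 k (ℕP.m<n⇒m<1+n k<N)))
                  (f≈0 N ℕP.≤-refl N≢k₀))
          (+-identityʳ _)

  sumBelow-swap : ∀ N M (f : ℕ → ℕ → Carrier) →
                  sumBelow N (λ a → sumBelow M (f a)) ≈ sumBelow M (λ b → sumBelow N (λ a → f a b))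
  sumBelow-swap zero M f = sym (sumBelow-zero M (λ _ → 0#) (λ _ _ → refl))
  sumBelow-swap (suc N) M f =
    trans (+-congʳ (sumBelow-swap N M f)) (sym (sumBelow-+ M (λ b → sumBelow N (λ a → f a b)) (f N)))

  sumBelow₂-zero : ∀ M N (g : ℕ → ℕ → Carrier) → (∀ x y → x < M → y < N → g x y ≈ 0#) →
                   sumBelow M (λ x → sumBelow N (g x)) ≈ 0#
  sumBelow₂-zero M N g g≈0 = sumBelow-zero M _ (λ x x<M → sumBelow-zero N (g x) (λ y y<N → g≈0 x y x<M y<N))

  sumBelow₂-single : ∀ M N (g : ℕ → ℕ → Carrier) x₀ y₀ → x₀ < M → y₀ < N →
    (∀ x y → x < M → y < N → x ≢ x₀ ⊎ y ≢ y₀ → g x y ≈ 0#) →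
    sumBelow M (λ x → sumBelow N (g x)) ≈ g x₀ y₀
  sumBelow₂-single M N g x₀ y₀ x₀<M y₀<N g≈0 =
    trans (sumBelow-single M _ x₀ x₀<M (λ x x<M x≢x₀ → sumBelow-zero N (g x) (λ y y<N → g≈0 x y x<M y<N (inj₁ x≢x₀))))
          (sumBelow-single N (g x₀) y₀ y₀<N (λ y y<N y≢y₀ → g≈0 x₀ y x₀<M y<N (inj₂ y≢y₀)))

  sumBelow-suc : ∀ N (f : ℕ → Carrier) → sumBelow (suc N) f ≈ f 0 + sumBelow N (f ∘ suc)
  sumBelow-suc zero f = trans (+-identityˡ _) (sym (+-identityʳ _))
  sumBelow-suc (suc N) f = trans (+-congʳ (sumBelow-suc N f)) (+-assoc _ _ _)

  sumBelow-extend : ∀ N M (f : ℕ → Carrier) → N ≤ M → (∀ k → N ≤ k → f k ≈ 0#) → sumBelow M f ≈ sumBelow N f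
  sumBelow-extend N M f N≤M f≈0 =
    ≡.subst (λ M → sumBelow M f ≈ sumBelow N f) (ℕP.m∸n+n≡m N≤M) (go (M ∸ N))
    where
    go : ∀ D → sumBelow (D ℕ.+ N) f ≈ sumBelow N f
    go zero = refl
    go (suc D) = trans (+-cong (go D) (f≈0 (D ℕ.+ N) (ℕP.m≤n+m N D))) (+-identityʳ _)

  sumBelow-reverse : ∀ N (f : ℕ → Carrier) → sumBelow N f ≈ sumBelow N (λ a → f (N ∸ suc a))
  sumBelow-reverse zero f = refl
  sumBelow-reverse (suc N) f =
    trans (+-congʳ (sumBelow-reverse N f)) (trans (+-comm _ _) (sym (sumBelow-suc N (λ a → f (suc N ∸ suc a)))))

  sumBelow-triangle : ∀ N (F : ℕ → ℕ → Carrier) →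
    sumBelow N (λ a → sumBelow (suc a) (λ b → F b a)) ≈ sumBelow N (λ b → sumBelow (N ∸ b) (λ c → F b (b ℕ.+ c)))
  sumBelow-triangle zero F = refl
  sumBelow-triangle (suc N) F = begin
    sumBelow N (λ a → sumBelow (suc a) (λ b → F b a)) + sumBelow (suc N) (λ b → F b N)
      ≈⟨ +-congʳ (sumBelow-triangle N F) ⟩
    sumBelow N (λ b → sumBelow (N ∸ b) (λ c → F b (b ℕ.+ c))) + sumBelow (suc N) (λ b → F b N)
      ≈⟨ +-congʳ (sym (trans (+-congˡ emptyRow) (+-identityʳ _))) ⟩
    sumBelow (suc N) (λ b → sumBelow (N ∸ b) (λ c → F b (b ℕ.+ c))) + sumBelow (suc N) (λ b → F b N)
      ≈⟨ sym (sumBelow-+ (suc N) _ _) ⟩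
    sumBelow (suc N) (λ b → sumBelow (N ∸ b) (λ c → F b (b ℕ.+ c)) + F b N)
      ≈⟨ sumBelow-cong-< (suc N) (λ b b<1+N → extendRow b (ℕP.≤-pred b<1+N)) ⟩
    sumBelow (suc N) (λ b → sumBelow (suc N ∸ b) (λ c → F b (b ℕ.+ c))) ∎
    where
    emptyRow : sumBelow (N ∸ N) (λ c → F N (N ℕ.+ c)) ≈ 0#
    emptyRow = ≡.subst (λ z → sumBelow z (λ c → F N (N ℕ.+ c)) ≈ 0#) (≡.sym (ℕP.n∸n≡0 N)) refl
    extendRow : ∀ b → b ≤ N →
      sumBelow (N ∸ b) (λ c → F b (b ℕ.+ c)) + F b N ≈ sumBelow (suc N ∸ b) (λ c → F b (b ℕ.+ c))
    extendRow b b≤N rewrite ℕP.+-∸-assoc 1 b≤N =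
      +-congˡ (≡.subst (λ z → F b N ≈ F b z) (≡.sym (ℕP.m+[n∸m]≡n b≤N)) refl)

  sumTo≈sumBelow : ∀ n (f : ℕ → Carrier) → sumTo n f ≈ sumBelow (suc n) f
  sumTo≈sumBelow zero f = sym (+-identityˡ _)
  sumTo≈sumBelow (suc n) f = +-congʳ (sumTo≈sumBelow n f)

  sumTo-cong : ∀ n {f g : ℕ → Carrier} → (∀ k → k ≤ n → f k ≈ g k) → sumTo n f ≈ sumTo n g
  sumTo-cong n {f} {g} eq = begin
    sumTo n f               ≈⟨ sumTo≈sumBelow n f ⟩
    sumBelow (suc n) f      ≈⟨ sumBelow-cong-< (suc n) (λ k k<1+n → eq k (ℕP.≤-pred k<1+n)) ⟩
    sumBelow (suc n) g      ≈⟨ sumTo≈sumBelow n g ⟨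
    sumTo n g               ∎

  sumTo-+ : ∀ n (f g : ℕ → Carrier) → sumTo n (λ k → f k + g k) ≈ sumTo n f + sumTo n g
  sumTo-+ n f g = trans (sumTo≈sumBelow n _)
    (trans (sumBelow-+ (suc n) f g) (+-cong (sym (sumTo≈sumBelow n f)) (sym (sumTo≈sumBelow n g))))

  sumTo-reverse : ∀ n (f : ℕ → Carrier) → sumTo n f ≈ sumTo n (λ a → f (n ∸ a))
  sumTo-reverse n f = trans (sumTo≈sumBelow n f)
    (trans (sumBelow-reverse (suc n) f) (sym (sumTo≈sumBelow n (λ a → f (n ∸ a)))))

  sumTo-head : ∀ n (f : ℕ → Carrier) → (∀ a → f (suc a) ≈ 0#) → sumTo n f ≈ f 0
  sumTo-head zero f f≈0 = refl
  sumTo-head (suc n) f f≈0 = trans (+-cong (sumTo-head n f f≈0) (f≈0 n)) (+-identityʳ _)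

module Powers {c ℓ} (K : CommutativeRing c ℓ) where
  open CommutativeRing K
  open Ops K
  open Sums K
  open import Relation.Binary.Reasoning.Setoid setoid
  open import Algebra.Properties.Ring ring using (-1*x≈-x)
  open import Algebra.Properties.CommutativeSemigroup *-commutativeSemigroup
    using (interchange; x∙yz≈xz∙y; xy∙z≈xz∙y)

  fromℕ-+ : ∀ m n → fromℕ (m ℕ.+ n) ≈ fromℕ m + fromℕ n
  fromℕ-+ zero n = sym (+-identityˡ _)
  fromℕ-+ (suc m) n = trans (+-congˡ (fromℕ-+ m n)) (sym (+-assoc _ _ _))

  fromℕ-* : ∀ m n → fromℕ (m ℕ.* n) ≈ fromℕ m * fromℕ n
  fromℕ-* zero n = sym (zeroˡ _)
  fromℕ-* (suc m) n = trans (fromℕ-+ n (m ℕ.* n))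
    (trans (+-cong (sym (*-identityˡ _)) (fromℕ-* m n)) (sym (distribʳ _ _ _)))

  pow-cong : ∀ {x y} n → x ≈ y → pow x n ≈ pow y n
  pow-cong zero x≈y = refl
  pow-cong (suc n) x≈y = *-cong x≈y (pow-cong n x≈y)

  pow-+ : ∀ x m n → pow x (m ℕ.+ n) ≈ pow x m * pow x n
  pow-+ x zero n = sym (*-identityˡ _)
  pow-+ x (suc m) n = trans (*-congˡ (pow-+ x m n)) (sym (*-assoc _ _ _))

  pow-* : ∀ x m n → pow x (m ℕ.* n) ≈ pow (pow x n) m
  pow-* x zero n = refl
  pow-* x (suc m) n = trans (pow-+ x n (m ℕ.* n)) (*-congˡ (pow-* x m n))

  pow-distrib-* : ∀ x y n → pow (x * y) n ≈ pow x n * pow y n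
  pow-distrib-* x y zero = sym (*-identityˡ _)
  pow-distrib-* x y (suc n) = trans (*-congˡ (pow-distrib-* x y n)) (interchange x y _ _)

  pow-1# : ∀ n → pow 1# n ≈ 1#
  pow-1# zero = refl
  pow-1# (suc n) = trans (*-identityˡ _) (pow-1# n)

  pow-neg : ∀ y n → pow (- y) n ≈ pow (- 1#) n * pow y n
  pow-neg y n = trans (pow-cong n (sym (-1*x≈-x y))) (pow-distrib-* (- 1#) y n)

  fromℕ-^ : ∀ m k → fromℕ (m ℕ.^ k) ≈ pow (fromℕ m) k
  fromℕ-^ m zero = +-identityʳ _
  fromℕ-^ m (suc k) = trans (fromℕ-* m (m ℕ.^ k)) (*-congˡ (fromℕ-^ m k))

  module _ where
    open import Algebra.Properties.CommutativeSemiring.Binomial commutativeSemiring as Binomial using ()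
    open import Algebra.Properties.Semiring.Exp semiring using (_^_)
    open import Algebra.Properties.Semiring.Sum semiring using (sum)
    open import Algebra.Definitions.RawMonoid +-rawMonoid using () renaming (_×_ to _×ᵐ_)

    private
      ^≡pow : ∀ x n → x ^ n ≡ pow x n
      ^≡pow x zero = ≡.refl
      ^≡pow x (suc n) = ≡.cong (x *_) (^≡pow x n)

      ×ᵐ≈fromℕ* : ∀ n x → n ×ᵐ x ≈ fromℕ n * x
      ×ᵐ≈fromℕ* zero x = sym (zeroˡ x)
      ×ᵐ≈fromℕ* (suc n) x = trans (+-cong (sym (*-identityˡ x)) (×ᵐ≈fromℕ* n x)) (sym (distribʳ _ _ _))

      sum≈sumBelow : ∀ N (g : ℕ → Carrier) → sum {N} (λ i → g (toℕ i)) ≈ sumBelow N g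
      sum≈sumBelow zero g = refl
      sum≈sumBelow (suc N) g = trans (+-congˡ (sum≈sumBelow N (g ∘ suc))) (sym (sumBelow-suc N g))

    binomial : ∀ n x y →
      pow (x + y) n ≈ sumBelow (suc n) (λ k → fromℕ (n C k) * (pow x k * pow y (n ∸ k)))
    binomial n x y = begin
      pow (x + y) n
        ≡⟨ ≡.sym (^≡pow (x + y) n) ⟩
      (x + y) ^ n
        ≈⟨ Binomial.theorem n x y ⟩
      sum {suc n} (λ i → (n C toℕ i) ×ᵐ (x ^ toℕ i * y ^ (n ∸ toℕ i)))
        ≈⟨ sum≈sumBelow (suc n) (λ k → (n C k) ×ᵐ (x ^ k * y ^ (n ∸ k))) ⟩
      sumBelow (suc n) (λ k → (n C k) ×ᵐ (x ^ k * y ^ (n ∸ k)))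
        ≈⟨ sumBelow-cong (suc n) (λ k → trans (×ᵐ≈fromℕ* (n C k) _)
             (*-congˡ (≡.subst₂ (λ a b → x ^ k * y ^ (n ∸ k) ≈ a * b) (^≡pow x k) (^≡pow y (n ∸ k)) refl))) ⟩
      sumBelow (suc n) (λ k → fromℕ (n C k) * (pow x k * pow y (n ∸ k))) ∎

  fromℕ-multiple : ∀ {p} → fromℕ p ≈ 0# → ∀ m → p ∣ m → fromℕ m ≈ 0#
  fromℕ-multiple {p} char-p m (divides t ≡.refl) = trans (fromℕ-* t p) (trans (*-congˡ char-p) (zeroʳ _))

  pow-+-prime : ∀ {p} → Prime p → fromℕ p ≈ 0# → ∀ x y → pow (x + y) p ≈ pow x p + pow y p
  pow-+-prime {zero} p-prime _ = ⊥-elim (ℕ.NonZero.nonZero (prime⇒nonZero p-prime))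
  pow-+-prime {p@(suc p-1)} p-prime char-p x y = begin
    pow (x + y) p                       ≈⟨ binomial p x y ⟩
    sumBelow p f + f p                  ≈⟨ +-congʳ (sumBelow-suc p-1 f) ⟩
    (f 0 + sumBelow p-1 (f ∘ suc)) + f p ≈⟨ +-congʳ (+-congˡ (sumBelow-zero p-1 (f ∘ suc) middle)) ⟩
    (f 0 + 0#) + f p                    ≈⟨ +-congʳ (+-identityʳ _) ⟩
    f 0 + f p                           ≈⟨ +-comm _ _ ⟩
    f p + f 0                           ≈⟨ +-cong last first ⟩
    pow x p + pow y p                   ∎
    where
    f : ℕ → Carrier
    f k = fromℕ (p C k) * (pow x k * pow y (p ∸ k))
    middle : ∀ k → k < p-1 → f (suc k) ≈ 0#
    middle k k<p-1 =
      trans (*-congʳ (fromℕ-multiple char-p _ (p∣pCk p-prime (s≤s z≤n) (s≤s k<p-1)))) (zeroˡ _)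
    last : f p ≈ pow x p
    last = begin
      fromℕ (p C p) * (pow x p * pow y (p ∸ p))
        ≡⟨ ≡.cong₂ (λ a b → fromℕ a * (pow x p * pow y b)) (ℕC.nCn≡1 p) (ℕP.n∸n≡0 p) ⟩
      (1# + 0#) * (pow x p * 1#)         ≈⟨ *-cong (+-identityʳ 1#) (*-identityʳ _) ⟩
      1# * pow x p                       ≈⟨ *-identityˡ _ ⟩
      pow x p                            ∎
    first : f 0 ≈ pow y p
    first = trans (*-cong (+-identityʳ 1#) (*-identityˡ _)) (*-identityˡ _)

  pow-+-prime^ : ∀ {p} → Prime p → fromℕ p ≈ 0# → ∀ k x y →
                 pow (x + y) (p ℕ.^ k) ≈ pow x (p ℕ.^ k) + pow y (p ℕ.^ k)
  pow-+-prime^ p-prime char-p zero x y =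
    trans (*-identityʳ _) (+-cong (sym (*-identityʳ x)) (sym (*-identityʳ y)))
  pow-+-prime^ {p} p-prime char-p (suc k) x y = begin
    pow (x + y) (p ℕ.* p ℕ.^ k)                         ≈⟨ pow-* (x + y) p (p ℕ.^ k) ⟩
    pow (pow (x + y) (p ℕ.^ k)) p                       ≈⟨ pow-cong p (pow-+-prime^ p-prime char-p k x y) ⟩
    pow (pow x (p ℕ.^ k) + pow y (p ℕ.^ k)) p           ≈⟨ pow-+-prime p-prime char-p _ _ ⟩
    pow (pow x (p ℕ.^ k)) p + pow (pow y (p ℕ.^ k)) p   ≈⟨ +-cong (sym (pow-* x p (p ℕ.^ k))) (sym (pow-* y p (p ℕ.^ k))) ⟩
    pow x (p ℕ.* p ℕ.^ k) + pow y (p ℕ.* p ℕ.^ k)       ∎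

  productCoeff : ℕ → ℕ → Carrier → Carrier → (ℕ → Carrier) → ℕ → ℕ → ℕ → Carrier
  productCoeff j n a t e m l u =
    ((fromℕ (j C m) * pow a (j ∸ m)) * (fromℕ (n C l) * (pow (- 1#) l * pow t (n ∸ l)))) * e u

  product-expansion : ∀ j n a t L (e : ℕ → Carrier) Y →
    pow (Y + a) j * (pow (- Y + t) n * sumBelow L (λ u → e u * pow Y u)) ≈
    sumBelow (suc j) (λ m → sumBelow (suc n) (λ l → sumBelow L (λ u →
      productCoeff j n a t e m l u * pow Y (m ℕ.+ l ℕ.+ u))))
  product-expansion j n a t L e Y = begin
    pow (Y + a) j * (pow (- Y + t) n * sumBelow L E)
      ≈⟨ *-cong (binomial j Y a) (*-congʳ (binomial n (- Y) t)) ⟩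
    sumBelow (suc j) U * (sumBelow (suc n) V * sumBelow L E)
      ≈⟨ *-congˡ (trans (*-distribʳ-sumBelow (suc n) _ V)
                        (sumBelow-cong (suc n) (λ l → *-distribˡ-sumBelow L (V l) E))) ⟩
    sumBelow (suc j) U * sumBelow (suc n) (λ l → sumBelow L (λ u → V l * E u))
      ≈⟨ trans (*-distribʳ-sumBelow (suc j) _ U) (sumBelow-cong (suc j) λ m →
           trans (*-distribˡ-sumBelow (suc n) (U m) _) (sumBelow-cong (suc n) λ l → *-distribˡ-sumBelow L (U m) _)) ⟩
    sumBelow (suc j) (λ m → sumBelow (suc n) (λ l → sumBelow L (λ u → U m * (V l * E u))))
      ≈⟨ sumBelow-cong (suc j) (λ m → sumBelow-cong (suc n) (λ l → sumBelow-cong L (λ u → term m l u))) ⟩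
    sumBelow (suc j) (λ m → sumBelow (suc n) (λ l → sumBelow L (λ u →
      productCoeff j n a t e m l u * pow Y (m ℕ.+ l ℕ.+ u)))) ∎
    where
    E : ℕ → Carrier
    E u = e u * pow Y u
    U : ℕ → Carrier
    U m = fromℕ (j C m) * (pow Y m * pow a (j ∸ m))
    V : ℕ → Carrier
    V l = fromℕ (n C l) * (pow (- Y) l * pow t (n ∸ l))
    term : ∀ m l u → U m * (V l * E u) ≈ productCoeff j n a t e m l u * pow Y (m ℕ.+ l ℕ.+ u)
    term m l u = begin
      U m * (V l * E u)
        ≈⟨ *-cong (x∙yz≈xz∙y _ _ _) (*-congʳ (*-congˡ (*-congʳ (pow-neg Y l)))) ⟩
      (uₘ * pow Y m) * ((fromℕ (n C l) * ((pow (- 1#) l * pow Y l) * pow t (n ∸ l))) * E u)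
        ≈⟨ *-congˡ (*-congʳ (trans (*-congˡ (xy∙z≈xz∙y _ _ _)) (sym (*-assoc _ _ _)))) ⟩
      (uₘ * pow Y m) * ((vₗ * pow Y l) * (e u * pow Y u))
        ≈⟨ *-congˡ (interchange _ _ _ _) ⟩
      (uₘ * pow Y m) * ((vₗ * e u) * (pow Y l * pow Y u))
        ≈⟨ interchange _ _ _ _ ⟩
      (uₘ * (vₗ * e u)) * (pow Y m * (pow Y l * pow Y u))
        ≈⟨ *-cong (sym (*-assoc _ _ _)) (sym (trans (pow-+ Y (m ℕ.+ l) u) (trans (*-congʳ (pow-+ Y m l)) (*-assoc _ _ _)))) ⟩
      productCoeff j n a t e m l u * pow Y (m ℕ.+ l ℕ.+ u) ∎
      where
      uₘ = fromℕ (j C m) * pow a (j ∸ m)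
      vₗ = fromℕ (n C l) * (pow (- 1#) l * pow t (n ∸ l))

module PowerSeries {c ℓ} (K : CommutativeRing c ℓ) where
  open CommutativeRing K
  open Ops K
  open Sums K
  open import Relation.Binary.Reasoning.Setoid setoid

  -T_ : PolyT → PolyT
  (-T f) e = - f e

  oneT : PolyT
  oneT = constT 1#

  *T-cong : ∀ {f f′ g g′} → f ≈T f′ → g ≈T g′ → (f *T g) ≈T (f′ *T g′)
  *T-cong f≈f′ g≈g′ e = sumTo-cong e (λ a _ → *-cong (f≈f′ a) (g≈g′ (e ∸ a)))

  constT-*T : ∀ x f → (constT x *T f) ≈T (λ e → x * f e)
  constT-*T x f e = sumTo-head e _ (λ a → zeroˡ _)

  *T-comm : ∀ f g → (f *T g) ≈T (g *T f)
  *T-comm f g e = trans (sumTo-reverse e _) (sumTo-cong e (λ a a≤e →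
    trans (*-comm _ _) (≡.subst (λ z → g z * f (e ∸ a) ≈ g a * f (e ∸ a)) (≡.sym (ℕP.m∸[m∸n]≡n a≤e)) refl)))

  *T-assoc : ∀ f g h → ((f *T g) *T h) ≈T (f *T (g *T h))
  *T-assoc f g h e = begin
    sumTo e (λ a → sumTo a (λ b → f b * g (a ∸ b)) * h (e ∸ a))
      ≈⟨ sumTo≈sumBelow e _ ⟩
    sumBelow (suc e) (λ a → sumTo a (λ b → f b * g (a ∸ b)) * h (e ∸ a))
      ≈⟨ sumBelow-cong (suc e) (λ a → trans (*-congʳ (sumTo≈sumBelow a _)) (*-distribʳ-sumBelow (suc a) _ _)) ⟩
    sumBelow (suc e) (λ a → sumBelow (suc a) (λ b → f b * g (a ∸ b) * h (e ∸ a)))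
      ≈⟨ sumBelow-triangle (suc e) (λ b a → f b * g (a ∸ b) * h (e ∸ a)) ⟩
    sumBelow (suc e) (λ b → sumBelow (suc e ∸ b) (λ c → f b * g ((b ℕ.+ c) ∸ b) * h (e ∸ (b ℕ.+ c))))
      ≈⟨ sumBelow-cong-< (suc e) (λ b b<1+e → row b (ℕP.≤-pred b<1+e)) ⟩
    sumBelow (suc e) (λ b → f b * sumTo (e ∸ b) (λ c → g c * h (e ∸ b ∸ c)))
      ≈⟨ sumTo≈sumBelow e _ ⟨
    sumTo e (λ b → f b * sumTo (e ∸ b) (λ c → g c * h (e ∸ b ∸ c))) ∎
    where
    row : ∀ b → b ≤ e → sumBelow (suc e ∸ b) (λ c → f b * g ((b ℕ.+ c) ∸ b) * h (e ∸ (b ℕ.+ c)))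
                        ≈ f b * sumTo (e ∸ b) (λ c → g c * h (e ∸ b ∸ c))
    row b b≤e rewrite ℕP.+-∸-assoc 1 b≤e = sym (trans (*-congˡ (sumTo≈sumBelow (e ∸ b) _))
      (trans (*-distribˡ-sumBelow (suc (e ∸ b)) _ _)
        (sumBelow-cong (suc (e ∸ b)) (λ c → ≡.subst₂ (λ u v → f b * (g c * h (e ∸ b ∸ c)) ≈ f b * g u * h v)
           (≡.sym (ℕP.m+n∸m≡n b c)) (ℕP.∸-+-assoc e b c) (sym (*-assoc _ _ _))))))

  *T-distribˡ : ∀ f g h → (f *T (g +T h)) ≈T ((f *T g) +T (f *T h))
  *T-distribˡ f g h e = trans (sumTo-cong e (λ a _ → distribˡ _ _ _)) (sumTo-+ e _ _)

  powerSeries-isCommutativeRing : IsCommutativeRing _≈T_ _+T_ _*T_ -T_ zeroT oneT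
  powerSeries-isCommutativeRing = record
    { isRing = record
      { +-isAbelianGroup = record
        { isGroup = record
          { isMonoid = record
            { isSemigroup = record
              { isMagma = record
                { isEquivalence = record
                  { refl = λ e → refl ; sym = λ f≈g e → sym (f≈g e) ; trans = λ f≈g g≈h e → trans (f≈g e) (g≈h e) }
                ; ∙-cong = λ f≈f′ g≈g′ e → +-cong (f≈f′ e) (g≈g′ e) }
              ; assoc = λ f g h e → +-assoc _ _ _ }
            ; identity = (λ f e → +-identityˡ _) , (λ f e → +-identityʳ _) }
          ; inverse = (λ f e → -‿inverseˡ _) , (λ f e → -‿inverseʳ _)
          ; ⁻¹-cong = λ f≈g e → -‿cong (f≈g e) }
        ; comm = λ f g e → +-comm _ _ }
      ; *-cong = *T-cong
      ; *-assoc = *T-assoc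
      ; *-identity = identityˡ , λ f e → trans (*T-comm f oneT e) (identityˡ f e)
      ; distrib = *T-distribˡ , λ f g h e → trans (*T-comm (g +T h) f e)
                                   (trans (*T-distribˡ f g h e) (+-cong (*T-comm f g e) (*T-comm f h e)))
      }
    ; *-comm = *T-comm
    }
    where
    identityˡ : ∀ f → (oneT *T f) ≈T f
    identityˡ f e = trans (constT-*T 1# f e) (*-identityˡ _)

  powerSeriesRing : CommutativeRing c ℓ
  powerSeriesRing = record { isCommutativeRing = powerSeries-isCommutativeRing }

module PowerSeriesProperties {c ℓ} (K : CommutativeRing c ℓ) where
  open CommutativeRing K
  open Ops K
  open Sums K
  open PowerSeries K
  private
    module A = CommutativeRing powerSeriesRing
    module OA = Ops powerSeriesRing

  constT-cong : ∀ {x y} → x ≈ y → constT x ≈T constT y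
  constT-cong x≈y zero = x≈y
  constT-cong x≈y (suc _) = refl

  constT-0# : constT 0# ≈T zeroT
  constT-0# zero = refl
  constT-0# (suc e) = refl

  constT-+ : ∀ a b → constT (a + b) ≈T (constT a +T constT b)
  constT-+ a b zero = refl
  constT-+ a b (suc e) = sym (+-identityˡ 0#)

  constT-* : ∀ a b → constT (a * b) ≈T (constT a *T constT b)
  constT-* a b e = sym (trans (constT-*T a (constT b) e) (scale e))
    where
    scale : ∀ e → a * constT b e ≈ constT (a * b) e
    scale zero = refl
    scale (suc e) = zeroʳ a

  constT-neg : ∀ a → constT (- a) ≈T (-T constT a)
  constT-neg a zero = refl
  constT-neg a (suc e) = sym (trans (sym (+-identityˡ _)) (-‿inverseʳ 0#))

  fromℕ-constT : ∀ n → OA.fromℕ n ≈T constT (fromℕ n)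
  fromℕ-constT zero = A.sym constT-0#
  fromℕ-constT (suc n) e = trans (+-congˡ (fromℕ-constT n e)) (sym (constT-+ 1# (fromℕ n) e))

  pow-constT : ∀ a n → OA.pow (constT a) n ≈T constT (pow a n)
  pow-constT a zero e = refl
  pow-constT a (suc n) e =
    trans (*T-cong {constT a} {constT a} (λ _ → refl) (pow-constT a n) e) (sym (constT-* a (pow a n) e))

  coeff-sumBelow : ∀ N (F : ℕ → PolyT) e → OA.sumBelow N F e ≈ sumBelow N (λ k → F k e)
  coeff-sumBelow zero F e = refl
  coeff-sumBelow (suc N) F e = +-congʳ (coeff-sumBelow N F e)

  XT*T-zero : ∀ f → (XT *T f) 0 ≈ 0#
  XT*T-zero f = zeroˡ _

  XT*T-suc : ∀ f e → (XT *T f) (suc e) ≈ f e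
  XT*T-suc f e = trans (sumTo≈sumBelow (suc e) _)
    (trans (sumBelow-single (suc (suc e)) _ 1 (s≤s (s≤s z≤n)) offDiagonal) (*-identityˡ _))
    where
    offDiagonal : ∀ k → k < suc (suc e) → k ≢ 1 → XT k * f (suc e ∸ k) ≈ 0#
    offDiagonal zero _ _ = zeroˡ _
    offDiagonal (suc zero) _ k≢1 = ⊥-elim (k≢1 ≡.refl)
    offDiagonal (suc (suc k)) _ _ = zeroˡ _

  XT^*T-≤ : ∀ m f e → m ≤ e → (OA.pow XT m *T f) e ≈ f (e ∸ m)
  XT^*T-≤ zero f e _ = trans (constT-*T 1# f e) (*-identityˡ _)
  XT^*T-≤ (suc m) f (suc e) (s≤s m≤e) =
    trans (A.*-assoc XT (OA.pow XT m) f (suc e)) (trans (XT*T-suc (OA.pow XT m *T f) e) (XT^*T-≤ m f e m≤e))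

  XT^*T-> : ∀ m f e → e < m → (OA.pow XT m *T f) e ≈ 0#
  XT^*T-> (suc m) f zero _ = trans (A.*-assoc XT (OA.pow XT m) f 0) (XT*T-zero (OA.pow XT m *T f))
  XT^*T-> (suc m) f (suc e) (s≤s e<m) =
    trans (A.*-assoc XT (OA.pow XT m) f (suc e)) (trans (XT*T-suc (OA.pow XT m *T f) e) (XT^*T-> m f e e<m))

  private
    XT^≈XT^*T1 : ∀ t → OA.pow XT t ≈T (OA.pow XT t *T oneT)
    XT^≈XT^*T1 t = A.sym (A.*-identityʳ (OA.pow XT t))

  XT^-coeff-≡ : ∀ t → OA.pow XT t t ≈ 1#
  XT^-coeff-≡ t = trans (XT^≈XT^*T1 t t)
    (trans (XT^*T-≤ t oneT t ℕP.≤-refl) (≡.subst (λ z → constT 1# z ≈ 1#) (≡.sym (ℕP.n∸n≡0 t)) refl))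

  XT^-coeff-≢ : ∀ t e → t ≢ e → OA.pow XT t e ≈ 0#
  XT^-coeff-≢ t e t≢e with t ≤? e
  ... | no t≰e = trans (XT^≈XT^*T1 t e) (XT^*T-> t oneT e (ℕP.≰⇒> t≰e))
  ... | yes t≤e = trans (XT^≈XT^*T1 t e)
    (trans (XT^*T-≤ t oneT e t≤e) (positive (e ∸ t) (t≢e ∘ ℕP.≤-antisym t≤e ∘ ℕP.m∸n≡0⇒m≤n)))
    where
    positive : ∀ u → u ≢ 0 → constT 1# u ≈ 0#
    positive zero u≢0 = ⊥-elim (u≢0 ≡.refl)
    positive (suc u) _ = refl

module Coefficients {c ℓ} (K : CommutativeRing c ℓ) where
  open CommutativeRing K
  open Ops K

  W₁-≤ : ∀ d {i j} → i ≤ j → W₁ d i j ≈ fromℕ (j C i) * pow d (j ∸ i)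
  W₁-≤ d {i} {j} i≤j with i ≤? j
  ... | yes _ = refl
  ... | no i≰j = ⊥-elim (i≰j i≤j)

  W₁-≰ : ∀ d {i j} → ¬ (i ≤ j) → W₁ d i j ≈ 0#
  W₁-≰ d {i} {j} i≰j with i ≤? j
  ... | yes i≤j = ⊥-elim (i≰j i≤j)
  ... | no _ = refl

  coeffΘ−-≤ : ∀ F {u v} → v ≤ u → coeffΘ− F u v ≡ coeffΘ F (u ∸ v)
  coeffΘ−-≤ F {u} {v} v≤u with v ≤? u
  ... | yes _ = ≡.refl
  ... | no v≰u = ⊥-elim (v≰u v≤u)

  coeffΘ−-≰ : ∀ F {u v} → ¬ (v ≤ u) → coeffΘ− F u v ≡ 0#
  coeffΘ−-≰ F {u} {v} v≰u with v ≤? u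
  ... | yes v≤u = ⊥-elim (v≰u v≤u)
  ... | no _ = ≡.refl

  coeffΘ-addΘ : ∀ f g e → coeffΘ (addΘ f g) e ≈ coeffΘ f e + coeffΘ g e
  coeffΘ-addΘ [] g e = sym (+-identityˡ _)
  coeffΘ-addΘ (a ∷ f) [] e = sym (+-identityʳ _)
  coeffΘ-addΘ (a ∷ f) (b ∷ g) zero = refl
  coeffΘ-addΘ (a ∷ f) (b ∷ g) (suc e) = coeffΘ-addΘ f g e

  coeffΘ-scaleΘ : ∀ x f e → coeffΘ (scaleΘ x f) e ≈ x * coeffΘ f e
  coeffΘ-scaleΘ x [] e = sym (zeroʳ x)
  coeffΘ-scaleΘ x (a ∷ f) zero = refl
  coeffΘ-scaleΘ x (a ∷ f) (suc e) = coeffΘ-scaleΘ x f e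

  coeffΘ-≥length : ∀ f e → length f ≤ e → coeffΘ f e ≈ 0#
  coeffΘ-≥length [] e _ = refl
  coeffΘ-≥length (a ∷ f) (suc e) (s≤s len≤e) = coeffΘ-≥length f e len≤e

-- Row k of 𝔐 reads θ-coefficients at the exponent (k+1)q - 1, where q = suc q′.
rowExponent : ℕ → ℕ → ℕ
rowExponent q′ k = q′ ℕ.+ k ℕ.* suc q′

rowExponent-% : ∀ q′ k → rowExponent q′ k ℕD.% suc q′ ≡ q′
rowExponent-% q′ k = ≡.trans (ℕD.[m+kn]%n≡m%n q′ k (suc q′)) (ℕD.m<n⇒m%n≡m (ℕP.n<1+n q′))

module MonomialRowShift {c ℓ} (K : CommutativeRing c ℓ) (q′ : ℕ) (d : CommutativeRing.Carrier K) where
  open CommutativeRing K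
  open Ops K
  open Sums K
  open Coefficients K
  open PowerSeries K
  open PowerSeriesProperties K
  private
    module A = CommutativeRing powerSeriesRing
    module OA = Ops powerSeriesRing
    module ΣA = Sums powerSeriesRing
    module PA = Powers powerSeriesRing
    q = suc q′
    row = rowExponent q′

  Y : PolyT
  Y = XT +T constT d

  module _ (w : ℕ) where
    private
      a = w ℕD./ q
      b = w ℕD.% q

    w≡b+a*q : w ≡ b ℕ.+ a ℕ.* q
    w≡b+a*q = ℕD.m≡m%n+[m/n]*n w q

    monomial-rowSum-digit : ∀ i N → w < N → b ≡ q′ →
      sumBelow N (λ k → W₁ d i k * OA.pow XT w (row k)) ≈ W₁ d i a
    monomial-rowSum-digit i N w<N b≡q′ =
      trans (sumBelow-single N _ a (ℕP.≤-<-trans (ℕD.m/n≤m w q) w<N) offRow)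
            (trans (*-congˡ (≡.subst (λ z → OA.pow XT w z ≈ 1#) w≡row (XT^-coeff-≡ w))) (*-identityʳ _))
      where
      w≡row : w ≡ row a
      w≡row = ≡.trans w≡b+a*q (≡.cong (ℕ._+ a ℕ.* q) b≡q′)
      offRow : ∀ k → k < N → k ≢ a → W₁ d i k * OA.pow XT w (row k) ≈ 0#
      offRow k _ k≢a = trans (*-congˡ (XT^-coeff-≢ w (row k) λ w≡rowk →
          k≢a (proj₂ (base-digits-injective q q′ k q′ a (ℕP.n<1+n q′) (ℕP.n<1+n q′) (≡.trans (≡.sym w≡rowk) w≡row)))))
        (zeroʳ _)

    monomial-rowSum-nondigit : ∀ i N → b ≢ q′ →
      sumBelow N (λ k → W₁ d i k * OA.pow XT w (row k)) ≈ 0#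
    monomial-rowSum-nondigit i N b≢q′ = sumBelow-zero N _ λ k _ →
      trans (*-congˡ (XT^-coeff-≢ w (row k) λ w≡rowk →
              b≢q′ (≡.trans (≡.cong (ℕD._% q) w≡rowk) (rowExponent-% q′ k))))
            (zeroʳ _)

  module _ (frobenius : OA.pow Y q ≈T (OA.pow XT q +T constT d)) where

    digitCoeff : ℕ → ℕ → ℕ → ℕ → Carrier
    digitCoeff a b c′ c = (fromℕ (b C c′) * pow d (b ∸ c′)) * (fromℕ (a C c) * pow d (a ∸ c))

    module _ (w : ℕ) where
      private
        a = w ℕD./ q
        b = w ℕD.% q
        open import Algebra.Properties.CommutativeSemigroup A.*-commutativeSemigroup
          using (interchange; x∙yz≈xz∙y)

      digitTerm : ℕ → ℕ → PolyT
      digitTerm c′ c = constT (digitCoeff a b c′ c) *T OA.pow XT (c′ ℕ.+ c ℕ.* q)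

      -- (X + d)^w = (X + d)^b (X^q + d)^a, where w = b + a q in base q.
      Y^-expansion : OA.pow Y w ≈T OA.sumBelow (suc b) (λ c′ → OA.sumBelow (suc a) (digitTerm c′))
      Y^-expansion = begin
        OA.pow Y w                                     ≡⟨ ≡.cong (OA.pow Y) (w≡b+a*q w) ⟩
        OA.pow Y (b ℕ.+ a ℕ.* q)                       ≈⟨ PA.pow-+ Y b (a ℕ.* q) ⟩
        OA.pow Y b *T OA.pow Y (a ℕ.* q)               ≈⟨ A.*-congˡ (PA.pow-* Y a q) ⟩
        OA.pow Y b *T OA.pow (OA.pow Y q) a            ≈⟨ A.*-congˡ (PA.pow-cong a frobenius) ⟩
        OA.pow Y b *T OA.pow (OA.pow XT q +T constT d) a
          ≈⟨ A.*-cong (PA.binomial b XT (constT d)) (PA.binomial a (OA.pow XT q) (constT d)) ⟩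
        OA.sumBelow (suc b) B *T OA.sumBelow (suc a) Aₐ
          ≈⟨ ΣA.*-distribʳ-sumBelow (suc b) (OA.sumBelow (suc a) Aₐ) B ⟩
        OA.sumBelow (suc b) (λ c′ → B c′ *T OA.sumBelow (suc a) Aₐ)
          ≈⟨ ΣA.sumBelow-cong (suc b) (λ c′ → ΣA.*-distribˡ-sumBelow (suc a) (B c′) Aₐ) ⟩
        OA.sumBelow (suc b) (λ c′ → OA.sumBelow (suc a) (λ c → B c′ *T Aₐ c))
          ≈⟨ ΣA.sumBelow-cong (suc b) (λ c′ → ΣA.sumBelow-cong (suc a) (term c′)) ⟩
        OA.sumBelow (suc b) (λ c′ → OA.sumBelow (suc a) (digitTerm c′)) ∎
        where
        open import Relation.Binary.Reasoning.Setoid A.setoid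
        B : ℕ → PolyT
        B c′ = OA.fromℕ (b C c′) *T (OA.pow XT c′ *T OA.pow (constT d) (b ∸ c′))
        Aₐ : ℕ → PolyT
        Aₐ c = OA.fromℕ (a C c) *T (OA.pow (OA.pow XT q) c *T OA.pow (constT d) (a ∸ c))
        constant : ∀ n k → (OA.fromℕ (n C k) *T OA.pow (constT d) (n ∸ k)) ≈T constT (fromℕ (n C k) * pow d (n ∸ k))
        constant n k = A.trans (A.*-cong (fromℕ-constT (n C k)) (pow-constT d (n ∸ k)))
                               (A.sym (constT-* (fromℕ (n C k)) (pow d (n ∸ k))))
        regroup : ∀ C₁ X₁ D₁ C₂ X₂ D₂ →
          ((C₁ *T (X₁ *T D₁)) *T (C₂ *T (X₂ *T D₂))) ≈T (((C₁ *T D₁) *T (C₂ *T D₂)) *T (X₁ *T X₂))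
        regroup C₁ X₁ D₁ C₂ X₂ D₂ =
          A.trans (A.*-cong (x∙yz≈xz∙y C₁ X₁ D₁) (x∙yz≈xz∙y C₂ X₂ D₂)) (interchange _ X₁ _ X₂)
        term : ∀ c′ c → (B c′ *T Aₐ c) ≈T digitTerm c′ c
        term c′ c = begin
          B c′ *T Aₐ c
            ≈⟨ regroup C₁ X₁ D₁ C₂ X₂ D₂ ⟩
          ((C₁ *T D₁) *T (C₂ *T D₂)) *T (X₁ *T X₂)
            ≈⟨ A.*-cong (A.trans (A.*-cong (constant b c′) (constant a c))
                                 (A.sym (constT-* (fromℕ (b C c′) * pow d (b ∸ c′)) (fromℕ (a C c) * pow d (a ∸ c)))))
                        (A.trans (A.*-congˡ (A.sym (PA.pow-* XT c q))) (A.sym (PA.pow-+ XT c′ (c ℕ.* q)))) ⟩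
          digitTerm c′ c ∎
          where
          C₁ = OA.fromℕ (b C c′)
          X₁ = OA.pow XT c′
          D₁ = OA.pow (constT d) (b ∸ c′)
          C₂ = OA.fromℕ (a C c)
          X₂ = OA.pow (OA.pow XT q) c
          D₂ = OA.pow (constT d) (a ∸ c)

      private
        termAt : ℕ → ℕ → ℕ → Carrier
        termAt i c′ c = digitCoeff a b c′ c * OA.pow XT (c′ ℕ.+ c ℕ.* q) (row i)

        b<q : b < q
        b<q = ℕD.m%n<n w q

      Y^-coeff : ∀ i → OA.pow Y w (row i) ≈ sumBelow (suc b) (λ c′ → sumBelow (suc a) (termAt i c′))
      Y^-coeff i = trans (Y^-expansion (row i))
        (trans (coeff-sumBelow (suc b) _ (row i))
          (sumBelow-cong (suc b) λ c′ → trans (coeff-sumBelow (suc a) _ (row i))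
            (sumBelow-cong (suc a) λ c → constT-*T (digitCoeff a b c′ c) (OA.pow XT (c′ ℕ.+ c ℕ.* q)) (row i))))

      termAt-offRow : ∀ i c′ c → c′ < suc b → c′ ≢ q′ ⊎ c ≢ i → termAt i c′ c ≈ 0#
      termAt-offRow i c′ c c′≤b off = trans (*-congˡ (XT^-coeff-≢ _ _ (onRow off))) (zeroʳ _)
        where
        onRow : c′ ≢ q′ ⊎ c ≢ i → c′ ℕ.+ c ℕ.* q ≢ row i
        onRow (inj₁ c′≢q′) eq = c′≢q′ (proj₁ (base-digits-injective q c′ c q′ i (ℕP.<-≤-trans c′≤b b<q) (ℕP.n<1+n q′) eq))
        onRow (inj₂ c≢i) eq = c≢i (proj₂ (base-digits-injective q c′ c q′ i (ℕP.<-≤-trans c′≤b b<q) (ℕP.n<1+n q′) eq))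

      Y^-coeff-digit : ∀ i → b ≡ q′ → OA.pow Y w (row i) ≈ W₁ d i a
      Y^-coeff-digit i b≡q′ = byCases (i ≤? a)
        where
        leading : ∀ b → b ≡ q′ → digitCoeff a b q′ i ≈ fromℕ (a C i) * pow d (a ∸ i)
        leading b ≡.refl = begin
          (fromℕ (q′ C q′) * pow d (q′ ∸ q′)) * (fromℕ (a C i) * pow d (a ∸ i))
            ≡⟨ ≡.cong₂ (λ m e → (fromℕ m * pow d e) * (fromℕ (a C i) * pow d (a ∸ i))) (ℕC.nCn≡1 q′) (ℕP.n∸n≡0 q′) ⟩
          ((1# + 0#) * 1#) * (fromℕ (a C i) * pow d (a ∸ i))
            ≈⟨ *-congʳ (trans (*-identityʳ _) (+-identityʳ 1#)) ⟩
          1# * (fromℕ (a C i) * pow d (a ∸ i))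
            ≈⟨ *-identityˡ _ ⟩
          fromℕ (a C i) * pow d (a ∸ i) ∎
          where open import Relation.Binary.Reasoning.Setoid setoid
        byCases : Dec (i ≤ a) → OA.pow Y w (row i) ≈ W₁ d i a
        byCases (no i≰a) = trans (Y^-coeff i) (trans (sumBelow₂-zero (suc b) (suc a) (termAt i)
              (λ c′ c c′≤b c≤a → termAt-offRow i c′ c c′≤b (inj₂ λ c≡i → i≰a (≡.subst (_≤ a) c≡i (ℕP.≤-pred c≤a)))))
              (sym (W₁-≰ d i≰a)))
        byCases (yes i≤a) = trans (Y^-coeff i) (trans (sumBelow₂-single (suc b) (suc a) (termAt i) q′ i
              (s≤s (ℕP.≤-reflexive (≡.sym b≡q′))) (s≤s i≤a) (λ c′ c c′≤b _ → termAt-offRow i c′ c c′≤b))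
              (trans (*-congˡ (XT^-coeff-≡ (row i))) (trans (*-identityʳ _)
                (trans (leading b b≡q′) (sym (W₁-≤ d i≤a))))))

      Y^-coeff-nondigit : ∀ i → b ≢ q′ → OA.pow Y w (row i) ≈ 0#
      Y^-coeff-nondigit i b≢q′ = trans (Y^-coeff i) (sumBelow₂-zero (suc b) (suc a) (termAt i)
        λ c′ c c′≤b _ → termAt-offRow i c′ c c′≤b (inj₁ λ c′≡q′ →
          b≢q′ (ℕP.≤-antisym (ℕP.≤-pred b<q) (≡.subst (_≤ b) c′≡q′ (ℕP.≤-pred c′≤b)))))

    monomial-rowSum : ∀ i N w → w < N →
      sumBelow N (λ k → W₁ d i k * OA.pow XT w (row k)) ≈ OA.pow Y w (row i)
    monomial-rowSum i N w w<N with w ℕD.% q ℕP.≟ q′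
    ... | yes b≡q′ = trans (monomial-rowSum-digit w i N w<N b≡q′) (sym (Y^-coeff-digit w i b≡q′))
    ... | no b≢q′ = trans (monomial-rowSum-nondigit w i N b≢q′) (sym (Y^-coeff-nondigit w i b≢q′))

-- Polynomials in T are power series A = R[[T]], and polynomials in θ over R[T] are power
-- series B = A[[θ]]; a polynomial F ∈ R[θ] is viewed in B as toSeries F.
module Matrices {c ℓ} (R : CommutativeRing c ℓ) (q′ : ℕ) where
  open CommutativeRing R
  open Ops R
  open Coefficients R
  open PowerSeries R
  open PowerSeriesProperties R
  private
    module A = CommutativeRing powerSeriesRing
    module OA = Ops powerSeriesRing
    module ΣA = Sums powerSeriesRing
    module PA = Powers powerSeriesRing
    module SA = PowerSeries powerSeriesRing
    module FA = PowerSeriesProperties powerSeriesRing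
    module B = CommutativeRing SA.powerSeriesRing
    module OB = Ops SA.powerSeriesRing
    module ΣB = Sums SA.powerSeriesRing
    module PB = Powers SA.powerSeriesRing
    q = suc q′
    row = rowExponent q′

  sumToT≈ : ∀ n F → sumToT n F ≈T OA.sumTo n F
  sumToT≈ zero F e = refl
  sumToT≈ (suc n) F e = +-congʳ (sumToT≈ n F e)

  sumBelowT≈ : ∀ N F → sumBelowT N F ≈T OA.sumBelow N F
  sumBelowT≈ zero F e = refl
  sumBelowT≈ (suc N) F e = +-congʳ (sumBelowT≈ N F e)

  powT≈ : ∀ f n → powT f n ≈T OA.pow f n
  powT≈ f zero e = refl
  powT≈ f (suc n) = *T-cong {f} {f} (λ _ → refl) (powT≈ f n)

  θ : OA.PolyT
  θ = OA.XT

  toSeries : PolyΘ → OA.PolyT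
  toSeries F e = constT (coeffΘ F e)

  θ^*toSeries-coeff : ∀ F k v →
    (OB.pow θ v OA.*T toSeries F) (row k) ≈T constT (coeffΘ− F (suc k ℕ.* q) (suc v))
  θ^*toSeries-coeff F k v with v ≤? row k
  ... | yes v≤row = A.trans (FA.XT^*T-≤ v (toSeries F) (row k) v≤row)
    (A.reflexive (≡.cong constT (≡.sym (coeffΘ−-≤ F (s≤s v≤row)))))
  ... | no v≰row = A.trans (FA.XT^*T-> v (toSeries F) (row k) (ℕP.≰⇒> v≰row))
    (A.trans (A.sym constT-0#) (A.reflexive (≡.cong constT (≡.sym (coeffΘ−-≰ F (v≰row ∘ ℕP.≤-pred))))))

  signedBinomial : ℕ → PolyT → ℕ → PolyT
  signedBinomial n τ l = OA.fromℕ (n C l) A.* (OA.pow (A.- A.1#) l A.* OA.pow τ (n ∸ l))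

  [τ-θ]^-expansion : ∀ n τ →
    OB.pow (B.- θ B.+ OA.constT τ) n B.≈ OB.sumBelow (suc n) (λ l → OA.constT (signedBinomial n τ l) B.* OB.pow θ l)
  [τ-θ]^-expansion n τ = B.trans (PB.binomial n (B.- θ) (OA.constT τ)) (ΣB.sumBelow-cong (suc n) term)
    where
    open import Relation.Binary.Reasoning.Setoid B.setoid
    open import Algebra.Properties.CommutativeSemigroup B.*-commutativeSemigroup using (xy∙z≈xz∙y)
    term : ∀ l → OB.fromℕ (n C l) B.* (OB.pow (B.- θ) l B.* OB.pow (OA.constT τ) (n ∸ l))
                   B.≈ OA.constT (signedBinomial n τ l) B.* OB.pow θ l
    term l = begin
      OB.fromℕ (n C l) B.* (OB.pow (B.- θ) l B.* OB.pow (OA.constT τ) (n ∸ l))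
        ≈⟨ B.*-congˡ {OB.fromℕ (n C l)} (B.*-congʳ {Tₙ} (PB.pow-neg θ l)) ⟩
      OB.fromℕ (n C l) B.* ((OB.pow (B.- B.1#) l B.* OB.pow θ l) B.* OB.pow (OA.constT τ) (n ∸ l))
        ≈⟨ B.trans (B.*-congˡ {OB.fromℕ (n C l)} (xy∙z≈xz∙y S Θ Tₙ)) (B.sym (B.*-assoc (OB.fromℕ (n C l)) (S B.* Tₙ) Θ)) ⟩
      (OB.fromℕ (n C l) B.* (OB.pow (B.- B.1#) l B.* OB.pow (OA.constT τ) (n ∸ l))) B.* OB.pow θ l
        ≈⟨ B.*-congʳ {Θ} (B.*-cong (FA.fromℕ-constT (n C l)) (B.*-cong sign (FA.pow-constT τ (n ∸ l)))) ⟩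
      (OA.constT (OA.fromℕ (n C l)) B.* (OA.constT (OA.pow (A.- A.1#) l) B.* OA.constT (OA.pow τ (n ∸ l)))) B.* OB.pow θ l
        ≈⟨ B.*-congʳ {Θ} (B.trans (B.*-congˡ {OA.constT (OA.fromℕ (n C l))} (B.sym (FA.constT-* (OA.pow (A.- A.1#) l) (OA.pow τ (n ∸ l)))))
                              (B.sym (FA.constT-* (OA.fromℕ (n C l)) (OA.pow (A.- A.1#) l A.* OA.pow τ (n ∸ l))))) ⟩
      OA.constT (signedBinomial n τ l) B.* OB.pow θ l ∎
      where
      S = OB.pow (B.- B.1#) l
      Θ = OB.pow θ l
      Tₙ = OB.pow (OA.constT τ) (n ∸ l)
      sign : OB.pow (B.- B.1#) l B.≈ OA.constT (OA.pow (A.- A.1#) l)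
      sign = B.trans (PB.pow-cong l (B.sym (FA.constT-neg A.1#))) (FA.pow-constT (A.- A.1#) l)

  θ^*[τ-θ]^-expansion : ∀ F n τ m →
    OB.pow θ m B.* (OB.pow (B.- θ B.+ OA.constT τ) n B.* toSeries F) B.≈
    OB.sumBelow (suc n) (λ l → OA.constT (signedBinomial n τ l) B.* (OB.pow θ (m ℕ.+ l) B.* toSeries F))
  θ^*[τ-θ]^-expansion F n τ m = begin
    Θₘ B.* (OB.pow (B.- θ B.+ OA.constT τ) n B.* toSeries F)
      ≈⟨ B.*-congˡ {Θₘ} (B.*-congʳ {toSeries F} ([τ-θ]^-expansion n τ)) ⟩
    Θₘ B.* (OB.sumBelow (suc n) (λ l → κ l B.* OB.pow θ l) B.* toSeries F)
      ≈⟨ B.*-congˡ {Θₘ} (ΣB.*-distribʳ-sumBelow (suc n) (toSeries F) (λ l → κ l B.* OB.pow θ l)) ⟩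
    Θₘ B.* OB.sumBelow (suc n) (λ l → (κ l B.* OB.pow θ l) B.* toSeries F)
      ≈⟨ ΣB.*-distribˡ-sumBelow (suc n) Θₘ (λ l → (κ l B.* OB.pow θ l) B.* toSeries F) ⟩
    OB.sumBelow (suc n) (λ l → Θₘ B.* ((κ l B.* OB.pow θ l) B.* toSeries F))
      ≈⟨ ΣB.sumBelow-cong (suc n) term ⟩
    OB.sumBelow (suc n) (λ l → κ l B.* (OB.pow θ (m ℕ.+ l) B.* toSeries F)) ∎
    where
    open import Relation.Binary.Reasoning.Setoid B.setoid
    open import Algebra.Properties.CommutativeSemigroup B.*-commutativeSemigroup using (x∙yz≈y∙xz)
    Θₘ = OB.pow θ m
    κ : ℕ → OA.PolyT
    κ l = OA.constT (signedBinomial n τ l)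
    term : ∀ l → Θₘ B.* ((κ l B.* OB.pow θ l) B.* toSeries F) B.≈ κ l B.* (OB.pow θ (m ℕ.+ l) B.* toSeries F)
    term l = begin
      Θₘ B.* ((κ l B.* OB.pow θ l) B.* toSeries F)
        ≈⟨ B.*-congˡ {Θₘ} (B.*-assoc (κ l) (OB.pow θ l) (toSeries F)) ⟩
      Θₘ B.* (κ l B.* (OB.pow θ l B.* toSeries F))
        ≈⟨ x∙yz≈y∙xz Θₘ (κ l) (OB.pow θ l B.* toSeries F) ⟩
      κ l B.* (Θₘ B.* (OB.pow θ l B.* toSeries F))
        ≈⟨ B.*-congˡ {κ l} (B.sym (B.*-assoc Θₘ (OB.pow θ l) (toSeries F))) ⟩
      κ l B.* ((Θₘ B.* OB.pow θ l) B.* toSeries F)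
        ≈⟨ B.*-congˡ {κ l} (B.*-congʳ {toSeries F} (B.sym (PB.pow-+ θ m l))) ⟩
      κ l B.* (OB.pow θ (m ℕ.+ l) B.* toSeries F) ∎

  𝔐-as-coeff : ∀ F n τ k m →
    𝔐 q F n τ k m ≈T (OB.pow θ m B.* (OB.pow (B.- θ B.+ OA.constT τ) n B.* toSeries F)) (row k)
  𝔐-as-coeff F n τ k m = begin
    𝔐 q F n τ k m
      ≈⟨ A.trans (sumToT≈ n G) (ΣA.sumTo≈sumBelow n G) ⟩
    OA.sumBelow (suc n) G
      ≈⟨ ΣA.sumBelow-cong (suc n) term ⟩
    OA.sumBelow (suc n) (λ l → signedBinomial n τ l A.* constT (b l))
      ≈⟨ ΣA.sumBelow-cong (suc n) (λ l → A.*-congˡ {signedBinomial n τ l} (A.sym (θ^*toSeries-coeff F k (m ℕ.+ l)))) ⟩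
    OA.sumBelow (suc n) (λ l → signedBinomial n τ l A.* (OB.pow θ (m ℕ.+ l) B.* toSeries F) (row k))
      ≈⟨ ΣA.sumBelow-cong (suc n) (λ l → A.sym (SA.constT-*T (signedBinomial n τ l) (OB.pow θ (m ℕ.+ l) B.* toSeries F) (row k))) ⟩
    OA.sumBelow (suc n) (λ l → (OA.constT (signedBinomial n τ l) B.* (OB.pow θ (m ℕ.+ l) B.* toSeries F)) (row k))
      ≈⟨ A.sym (FA.coeff-sumBelow (suc n) (λ l → OA.constT (signedBinomial n τ l) B.* (OB.pow θ (m ℕ.+ l) B.* toSeries F)) (row k)) ⟩
    OB.sumBelow (suc n) (λ l → OA.constT (signedBinomial n τ l) B.* (OB.pow θ (m ℕ.+ l) B.* toSeries F)) (row k)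
      ≈⟨ B.sym (θ^*[τ-θ]^-expansion F n τ m) (row k) ⟩
    (OB.pow θ m B.* (OB.pow (B.- θ B.+ OA.constT τ) n B.* toSeries F)) (row k) ∎
    where
    open import Relation.Binary.Reasoning.Setoid A.setoid
    b : ℕ → Carrier
    b l = coeffΘ− F (suc k ℕ.* q) (suc m ℕ.+ l)
    G : ℕ → PolyT
    G l = powT τ (n ∸ l) *T constT (pow (- 1#) l * (fromℕ (n C l) * b l))
    constant : ∀ l → constT (pow (- 1#) l * (fromℕ (n C l) * b l)) ≈T
                     (OA.pow (A.- A.1#) l A.* (OA.fromℕ (n C l) A.* constT (b l)))
    constant l = A.trans (constT-* (pow (- 1#) l) (fromℕ (n C l) * b l))
      (A.*-cong (A.trans (A.sym (pow-constT (- 1#) l)) (PA.pow-cong l (constT-neg 1#)))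
                (A.trans (constT-* (fromℕ (n C l)) (b l)) (A.*-congʳ {constT (b l)} (A.sym (fromℕ-constT (n C l))))))
    term : ∀ l → G l ≈T (signedBinomial n τ l A.* constT (b l))
    term l = A.trans (A.*-cong (powT≈ τ (n ∸ l)) (constant l)) 
      (regroup (OA.pow τ (n ∸ l)) (OA.pow (A.- A.1#) l) (OA.fromℕ (n C l)) (constT (b l)))
      where
      open import Algebra.Properties.CommutativeSemigroup A.*-commutativeSemigroup using (x∙yz≈yx∙z; x∙yz≈y∙zx)
      regroup : ∀ t s c x → (t A.* (s A.* (c A.* x))) ≈T ((c A.* (s A.* t)) A.* x)
      regroup t s c x = A.trans (A.*-congˡ {t} (x∙yz≈yx∙z s c x))
        (A.trans (A.sym (A.*-assoc t (c A.* s) x)) (A.*-congʳ {x} (x∙yz≈y∙zx t c s)))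

  toSeries-addΘ : ∀ f g → toSeries (addΘ f g) B.≈ (toSeries f B.+ toSeries g)
  toSeries-addΘ f g e = A.trans (constT-cong (coeffΘ-addΘ f g e)) (constT-+ (coeffΘ f e) (coeffΘ g e))

  toSeries-scaleΘ : ∀ x f → toSeries (scaleΘ x f) B.≈ (OA.constT (constT x) B.* toSeries f)
  toSeries-scaleΘ x f e = A.trans (constT-cong (coeffΘ-scaleΘ x f e))
    (A.trans (constT-* x (coeffΘ f e)) (A.sym (SA.constT-*T (constT x) (toSeries f) e)))

  toSeries-shift : ∀ f → toSeries (0# ∷ f) B.≈ (θ B.* toSeries f)
  toSeries-shift f zero = A.trans constT-0# (A.sym (FA.XT*T-zero (toSeries f)))
  toSeries-shift f (suc e) = A.sym (FA.XT*T-suc (toSeries f) e)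

  toSeries-const : ∀ a → toSeries (a ∷ []) B.≈ OA.constT (constT a)
  toSeries-const a zero = A.refl
  toSeries-const a (suc e) = constT-0#

  evalAt : PolyΘ → OA.PolyT → OA.PolyT
  evalAt P Y = OB.sumBelow (length P) (λ u → OA.constT (toSeries P u) B.* OB.pow Y u)

  toSeries-μ : ∀ d P → toSeries (μ d P) B.≈ evalAt P (θ B.+ OA.constT (constT d))
  toSeries-μ d [] e = constT-0#
  toSeries-μ d (a ∷ Q) = begin
    toSeries (addΘ (a ∷ []) (mulθ+d d (μ d Q)))
      ≈⟨ toSeries-addΘ (a ∷ []) (mulθ+d d (μ d Q)) ⟩
    toSeries (a ∷ []) B.+ toSeries (addΘ (0# ∷ μ d Q) (scaleΘ d (μ d Q)))
      ≈⟨ B.+-cong (toSeries-const a) (toSeries-addΘ (0# ∷ μ d Q) (scaleΘ d (μ d Q))) ⟩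
    ĉ a B.+ (toSeries (0# ∷ μ d Q) B.+ toSeries (scaleΘ d (μ d Q)))
      ≈⟨ B.+-congˡ {ĉ a} (B.+-cong (toSeries-shift (μ d Q)) (toSeries-scaleΘ d (μ d Q))) ⟩
    ĉ a B.+ (θ B.* toSeries (μ d Q) B.+ ĉ d B.* toSeries (μ d Q))
      ≈⟨ B.+-congˡ {ĉ a} (B.sym (B.distribʳ (toSeries (μ d Q)) θ (ĉ d))) ⟩
    ĉ a B.+ Y B.* toSeries (μ d Q)
      ≈⟨ B.+-congˡ {ĉ a} (B.*-congˡ {Y} (toSeries-μ d Q)) ⟩
    ĉ a B.+ Y B.* evalAt Q Y
      ≈⟨ B.+-cong (B.sym (B.*-identityʳ (ĉ a))) (ΣB.*-distribˡ-sumBelow (length Q) Y (λ u → OA.constT (toSeries Q u) B.* OB.pow Y u)) ⟩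
    ĉ a B.* B.1# B.+ OB.sumBelow (length Q) (λ u → Y B.* (OA.constT (toSeries Q u) B.* OB.pow Y u))
      ≈⟨ B.+-congˡ {ĉ a B.* B.1#} (ΣB.sumBelow-cong (length Q) λ u → x∙yz≈y∙xz Y (OA.constT (toSeries Q u)) (OB.pow Y u)) ⟩
    ĉ a B.* B.1# B.+ OB.sumBelow (length Q) (λ u → OA.constT (toSeries Q u) B.* (Y B.* OB.pow Y u))
      ≈⟨ ΣB.sumBelow-suc (length Q) (λ u → OA.constT (toSeries (a ∷ Q) u) B.* OB.pow Y u) ⟨
    evalAt (a ∷ Q) Y ∎
    where
    open import Relation.Binary.Reasoning.Setoid B.setoid
    open import Algebra.Properties.CommutativeSemigroup B.*-commutativeSemigroup using (x∙yz≈y∙xz)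
    ĉ : Carrier → OA.PolyT
    ĉ x = OA.constT (constT x)
    Y = θ B.+ ĉ d

  evalAt-θ : ∀ P → evalAt P θ B.≈ toSeries P
  evalAt-θ P e = A.trans (FA.coeff-sumBelow (length P) _ e)
    (A.trans (ΣA.sumBelow-cong (length P) (λ u → SA.constT-*T (toSeries P u) (OB.pow θ u) e)) (coefficient (e <? length P)))
    where
    coefficient : Dec (e < length P) → OA.sumBelow (length P) (λ u → toSeries P u A.* OB.pow θ u e) ≈T toSeries P e
    coefficient (yes e<len) = A.trans
      (ΣA.sumBelow-single (length P) _ e e<len
        (λ u _ u≢e → A.trans (A.*-congˡ {toSeries P u} (FA.XT^-coeff-≢ u e u≢e)) (A.zeroʳ (toSeries P u))))
      (A.trans (A.*-congˡ {toSeries P e} (FA.XT^-coeff-≡ e)) (A.*-identityʳ (toSeries P e)))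
    coefficient (no e≮len) = A.trans
      (ΣA.sumBelow-zero (length P) _
        (λ u u<len → A.trans (A.*-congˡ {toSeries P u} (FA.XT^-coeff-≢ u e λ u≡e → e≮len (≡.subst (_< length P) u≡e u<len)))
                             (A.zeroʳ (toSeries P u))))
      (A.sym (A.trans (constT-cong (coeffΘ-≥length P e (ℕP.≮⇒≥ e≮len))) constT-0#))

  W₁-constT : ∀ d i k → OA.W₁ (constT d) i k ≈T constT (W₁ d i k)
  W₁-constT d i k with i ≤? k
  ... | yes _ = A.trans (A.*-cong (fromℕ-constT (k C i)) (pow-constT d (k ∸ i)))
                        (A.sym (constT-* (fromℕ (k C i)) (pow d (k ∸ i))))
  ... | no _ = A.sym constT-0#

  W₁-columnSum : ∀ d j N → j < N →
    OB.sumBelow N (λ m → OA.constT (constT (W₁ d m j)) B.* OB.pow θ m) B.≈ OB.pow (θ B.+ OA.constT (constT d)) j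
  W₁-columnSum d j N j<N = begin
    OB.sumBelow N term
      ≈⟨ ΣB.sumBelow-extend (suc j) N term j<N belowDiagonal ⟩
    OB.sumBelow (suc j) term
      ≈⟨ ΣB.sumBelow-cong-< (suc j) binomialTerm ⟨
    OB.sumBelow (suc j) (λ m → OB.fromℕ (j C m) B.* (OB.pow θ m B.* OB.pow ĉd (j ∸ m)))
      ≈⟨ PB.binomial j θ ĉd ⟨
    OB.pow (θ B.+ ĉd) j ∎
    where
    open import Relation.Binary.Reasoning.Setoid B.setoid
    open import Algebra.Properties.CommutativeSemigroup B.*-commutativeSemigroup using (x∙yz≈xz∙y)
    ĉd = OA.constT (constT d)
    term : ℕ → OA.PolyT
    term m = OA.constT (constT (W₁ d m j)) B.* OB.pow θ m
    ĉ-cong : ∀ {a b} → a ≈T b → OA.constT a B.≈ OA.constT b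
    ĉ-cong = FA.constT-cong
    belowDiagonal : ∀ m → suc j ≤ m → term m B.≈ B.0#
    belowDiagonal m j<m = B.trans (B.*-congʳ {OB.pow θ m}
        (B.trans (ĉ-cong (A.trans (constT-cong (W₁-≰ d (ℕP.<⇒≱ j<m))) constT-0#)) FA.constT-0#))
      (B.zeroˡ (OB.pow θ m))
    binomialTerm : ∀ m → m < suc j → OB.fromℕ (j C m) B.* (OB.pow θ m B.* OB.pow ĉd (j ∸ m)) B.≈ term m
    binomialTerm m m<1+j = B.trans (x∙yz≈xz∙y (OB.fromℕ (j C m)) (OB.pow θ m) (OB.pow ĉd (j ∸ m)))
      (B.*-congʳ {OB.pow θ m} coefficient)
      where
      coefficient : OB.fromℕ (j C m) B.* OB.pow ĉd (j ∸ m) B.≈ OA.constT (constT (W₁ d m j))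
      coefficient = begin
        OB.fromℕ (j C m) B.* OB.pow ĉd (j ∸ m)
          ≈⟨ B.*-cong (FA.fromℕ-constT (j C m)) (FA.pow-constT (constT d) (j ∸ m)) ⟩
        OA.constT (OA.fromℕ (j C m)) B.* OA.constT (OA.pow (constT d) (j ∸ m))
          ≈⟨ FA.constT-* (OA.fromℕ (j C m)) (OA.pow (constT d) (j ∸ m)) ⟨
        OA.constT (OA.fromℕ (j C m) A.* OA.pow (constT d) (j ∸ m))
          ≈⟨ ĉ-cong (A.*-cong (fromℕ-constT (j C m)) (pow-constT d (j ∸ m))) ⟩
        OA.constT (constT (fromℕ (j C m)) A.* constT (pow d (j ∸ m)))
          ≈⟨ ĉ-cong (constT-* (fromℕ (j C m)) (pow d (j ∸ m))) ⟨
        OA.constT (constT (fromℕ (j C m) * pow d (j ∸ m)))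
          ≈⟨ ĉ-cong (constT-cong (W₁-≤ d (ℕP.≤-pred m<1+j))) ⟨
        OA.constT (constT (W₁ d m j)) ∎

  θ+d-frobenius : ∀ {p} k → Prime p → q ≡ p ℕ.^ k → fromℕ p ≈ 0# → ∀ d → pow d q ≈ d →
    OB.pow (θ B.+ OA.constT (constT d)) q B.≈ (OB.pow θ q B.+ OA.constT (constT d))
  θ+d-frobenius {p} k p-prime q≡p^k char-p d d^q≈d =
    ≡.subst (λ e → OB.pow (θ B.+ ĉd) e B.≈ (OB.pow θ e B.+ ĉd)) (≡.sym q≡p^k)
      (B.trans (PB.pow-+-prime^ p-prime char-p-B k θ ĉd)
               (B.+-congˡ {OB.pow θ (p ℕ.^ k)} (B.trans (FA.pow-constT (constT d) (p ℕ.^ k))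
                 (FA.constT-cong (A.trans (pow-constT d (p ℕ.^ k))
                   (constT-cong (≡.subst (λ e → pow d e ≈ d) q≡p^k d^q≈d)))))))
    where
    ĉd = OA.constT (constT d)
    char-p-B : OB.fromℕ p B.≈ B.0#
    char-p-B = B.trans (FA.fromℕ-constT p)
      (B.trans (FA.constT-cong (A.trans (fromℕ-constT p) (A.trans (constT-cong char-p) constT-0#))) FA.constT-0#)

  module Conjugation (d : Carrier)
      (frobenius : OB.pow (θ B.+ OA.constT (constT d)) q B.≈ (OB.pow θ q B.+ OA.constT (constT d))) where

    Y : OA.PolyT
    Y = θ B.+ OA.constT (constT d)

    RowShifts : ℕ → ℕ → OA.PolyT → OA.PolyT → Set ℓ
    RowShifts i N G₁ G₂ = OA.sumBelow N (λ k → constT (W₁ d i k) A.* G₁ (row k)) ≈T G₂ (row i)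

    rowShifts-cong : ∀ i N {G₁ G₁′ G₂ G₂′} → G₁ B.≈ G₁′ → G₂ B.≈ G₂′ → RowShifts i N G₁ G₂ → RowShifts i N G₁′ G₂′
    rowShifts-cong i N G₁≈G₁′ G₂≈G₂′ shifts =
      A.trans (ΣA.sumBelow-cong N (λ k → A.*-congˡ {constT (W₁ d i k)} (A.sym (G₁≈G₁′ (row k)))))
              (A.trans shifts (G₂≈G₂′ (row i)))

    rowShifts-sum : ∀ i N M (G₁ G₂ : ℕ → OA.PolyT) → (∀ x → x < M → RowShifts i N (G₁ x) (G₂ x)) →
                    RowShifts i N (OB.sumBelow M G₁) (OB.sumBelow M G₂)
    rowShifts-sum i N M G₁ G₂ shifts = A.trans
      (ΣA.sumBelow-cong N λ k → A.trans (A.*-congˡ {constT (W₁ d i k)} (FA.coeff-sumBelow M G₁ (row k)))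
                                         (ΣA.*-distribˡ-sumBelow M (constT (W₁ d i k)) (λ x → G₁ x (row k))))
      (A.trans (ΣA.sumBelow-swap N M λ k x → constT (W₁ d i k) A.* G₁ x (row k))
        (A.trans (ΣA.sumBelow-cong-< M shifts) (A.sym (FA.coeff-sumBelow M G₂ (row i)))))

    rowShifts-monomial : ∀ i N γ w → w < N →
      RowShifts i N (OA.constT γ B.* OB.pow θ w) (OA.constT γ B.* OB.pow Y w)
    rowShifts-monomial i N γ w w<N = begin
      OA.sumBelow N (λ k → constT (W₁ d i k) A.* (OA.constT γ B.* OB.pow θ w) (row k))
        ≈⟨ ΣA.sumBelow-cong N (λ k → A.*-congˡ {constT (W₁ d i k)} (SA.constT-*T γ (OB.pow θ w) (row k))) ⟩
      OA.sumBelow N (λ k → constT (W₁ d i k) A.* (γ A.* OB.pow θ w (row k)))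
        ≈⟨ ΣA.sumBelow-cong N (λ k → x∙yz≈y∙xz (constT (W₁ d i k)) γ (OB.pow θ w (row k))) ⟩
      OA.sumBelow N (λ k → γ A.* (constT (W₁ d i k) A.* OB.pow θ w (row k)))
        ≈⟨ ΣA.*-distribˡ-sumBelow N γ (λ k → constT (W₁ d i k) A.* OB.pow θ w (row k)) ⟨
      γ A.* OA.sumBelow N (λ k → constT (W₁ d i k) A.* OB.pow θ w (row k))
        ≈⟨ A.*-congˡ {γ} (ΣA.sumBelow-cong N λ k → A.*-congʳ {OB.pow θ w (row k)} (W₁-constT d i k)) ⟨
      γ A.* OA.sumBelow N (λ k → OA.W₁ (constT d) i k A.* OB.pow θ w (row k))
        ≈⟨ A.*-congˡ {γ} (MonomialRowShift.monomial-rowSum powerSeriesRing q′ (constT d) frobenius i N w w<N) ⟩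
      γ A.* OB.pow Y w (row i)
        ≈⟨ SA.constT-*T γ (OB.pow Y w) (row i) ⟨
      (OA.constT γ B.* OB.pow Y w) (row i) ∎
      where
      open import Relation.Binary.Reasoning.Setoid A.setoid
      open import Algebra.Properties.CommutativeSemigroup A.*-commutativeSemigroup using (x∙yz≈y∙xz)

    shiftedProduct : ℕ → ℕ → PolyΘ → OA.PolyT → OA.PolyT
    shiftedProduct j n P Z =
      OB.pow (Z B.+ OA.constT (constT (- d))) j B.* (OB.pow (B.- Z B.+ OA.constT XT) n B.* evalAt P Z)

    rowShifts-shiftedProduct : ∀ i N j n P → j ℕ.+ n ℕ.+ length P < N →
      RowShifts i N (shiftedProduct j n P θ) (shiftedProduct j n P Y)
    rowShifts-shiftedProduct i N j n P bound =
      rowShifts-cong i N (B.sym (expansion θ)) (B.sym (expansion Y))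
        (rowShifts-sum i N (suc j) _ _ λ m m≤j → rowShifts-sum i N (suc n) _ _ λ l l≤n → rowShifts-sum i N (length P) _ _ λ u u<len →
          rowShifts-cong i N (B.*-congʳ {OB.pow θ (m ℕ.+ l ℕ.+ u)} (B.sym (coefficient m l u)))
                         (B.*-congʳ {OB.pow Y (m ℕ.+ l ℕ.+ u)} (B.sym (coefficient m l u)))
                         (rowShifts-monomial i N _ (m ℕ.+ l ℕ.+ u) (exponent<N m≤j l≤n u<len)))
      where
      ĉ = OA.constT
      a = ĉ (constT (- d))
      e : ℕ → OA.PolyT
      e u = ĉ (toSeries P u)
      expansion : ∀ Z → shiftedProduct j n P Z B.≈
        OB.sumBelow (suc j) (λ m → OB.sumBelow (suc n) (λ l → OB.sumBelow (length P) (λ u →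
          PB.productCoeff j n a (ĉ XT) e m l u B.* OB.pow Z (m ℕ.+ l ℕ.+ u))))
      expansion = PB.product-expansion j n a (ĉ XT) (length P) e
      ĉ-* : ∀ {x y a b} → x B.≈ ĉ a → y B.≈ ĉ b → x B.* y B.≈ ĉ (a A.* b)
      ĉ-* {a = a} {b} x≈ y≈ = B.trans (B.*-cong x≈ y≈) (B.sym (FA.constT-* a b))
      coefficient : ∀ m l u → PB.productCoeff j n a (ĉ XT) e m l u B.≈ ĉ (PA.productCoeff j n (constT (- d)) XT (toSeries P) m l u)
      coefficient m l u =
        ĉ-* (ĉ-* (ĉ-* (FA.fromℕ-constT (j C m)) (FA.pow-constT (constT (- d)) (j ∸ m)))
                 (ĉ-* (FA.fromℕ-constT (n C l))
                      (ĉ-* (B.trans (PB.pow-cong l (B.sym (FA.constT-neg A.1#))) (FA.pow-constT (A.- A.1#) l))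
                           (FA.pow-constT XT (n ∸ l)))))
            (B.refl {e u})
      exponent<N : ∀ {m l u} → m < suc j → l < suc n → u < length P → m ℕ.+ l ℕ.+ u < N
      exponent<N m≤j l≤n u<len = ℕP.<-≤-trans
        (s≤s (ℕP.+-mono-≤ (ℕP.+-mono-≤ (ℕP.≤-pred m≤j) (ℕP.≤-pred l≤n)) (ℕP.<⇒≤ u<len))) bound

    𝔐-μ-as-coeff : ∀ i j n P → 𝔐 q (μ d P) n (XT +T constT (- d)) i j ≈T shiftedProduct j n P Y (row i)
    𝔐-μ-as-coeff i j n P = A.trans (𝔐-as-coeff (μ d P) n (XT +T constT (- d)) i j)
      (B.sym (B.*-cong (PB.pow-cong j Y-d≈θ) (B.*-cong (PB.pow-cong n -Y+T≈-θ+T-d) (B.sym (toSeries-μ d P)))) (row i))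
      where
      open import Algebra.Properties.AbelianGroup B.+-abelianGroup using (⁻¹-∙-comm)
      ĉ = OA.constT
      Y-d≈θ : Y B.+ ĉ (constT (- d)) B.≈ θ
      Y-d≈θ = begin
        (θ B.+ ĉ (constT d)) B.+ ĉ (constT (- d)) ≈⟨ B.+-assoc θ (ĉ (constT d)) (ĉ (constT (- d))) ⟩
        θ B.+ (ĉ (constT d) B.+ ĉ (constT (- d))) ≈⟨ B.+-congˡ {θ} (FA.constT-+ (constT d) (constT (- d))) ⟨
        θ B.+ ĉ (constT d A.+ constT (- d))       ≈⟨ B.+-congˡ {θ} (FA.constT-cong (constT-+ d (- d))) ⟨
        θ B.+ ĉ (constT (d + - d))                ≈⟨ B.+-congˡ {θ} (FA.constT-cong (constT-cong (-‿inverseʳ d))) ⟩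
        θ B.+ ĉ (constT 0#)                       ≈⟨ B.+-congˡ {θ} (B.trans (FA.constT-cong constT-0#) FA.constT-0#) ⟩
        θ B.+ B.0#                                ≈⟨ B.+-identityʳ θ ⟩
        θ                                         ∎
        where open import Relation.Binary.Reasoning.Setoid B.setoid
      -Y+T≈-θ+T-d : B.- Y B.+ ĉ XT B.≈ B.- θ B.+ ĉ (XT +T constT (- d))
      -Y+T≈-θ+T-d = begin
        B.- (θ B.+ ĉ (constT d)) B.+ ĉ XT         ≈⟨ B.+-congʳ {ĉ XT} (⁻¹-∙-comm θ (ĉ (constT d))) ⟨
        (B.- θ B.+ B.- ĉ (constT d)) B.+ ĉ XT     ≈⟨ B.+-assoc (B.- θ) (B.- ĉ (constT d)) (ĉ XT) ⟩
        B.- θ B.+ (B.- ĉ (constT d) B.+ ĉ XT)     ≈⟨ B.+-congˡ {B.- θ} (B.+-comm (B.- ĉ (constT d)) (ĉ XT)) ⟩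
        B.- θ B.+ (ĉ XT B.+ B.- ĉ (constT d))     ≈⟨ B.+-congˡ {B.- θ} (B.+-congˡ {ĉ XT} (B.trans (FA.constT-cong (constT-neg d)) (FA.constT-neg (constT d)))) ⟨
        B.- θ B.+ (ĉ XT B.+ ĉ (constT (- d)))     ≈⟨ B.+-congˡ {B.- θ} (FA.constT-+ XT (constT (- d))) ⟨
        B.- θ B.+ ĉ (XT +T constT (- d))          ∎
        where open import Relation.Binary.Reasoning.Setoid B.setoid

    columnSum-as-coeff : ∀ k j n P N → j < N →
      OA.sumBelow N (λ m → 𝔐 q P n XT k m A.* constT (W₁ (- d) m j)) ≈T shiftedProduct j n P θ (row k)
    columnSum-as-coeff k j n P N j<N = begin
      OA.sumBelow N (λ m → 𝔐 q P n XT k m A.* constT (W₁ (- d) m j))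
        ≈⟨ ΣA.sumBelow-cong N (λ m → A.trans (A.*-congʳ {wₘ m} (𝔐-as-coeff P n XT k m))
             (A.trans (A.*-comm ((OB.pow θ m B.* Z) (row k)) (wₘ m)) (A.sym (SA.constT-*T (wₘ m) (OB.pow θ m B.* Z) (row k))))) ⟩
      OA.sumBelow N (λ m → (ĉ (wₘ m) B.* (OB.pow θ m B.* Z)) (row k))
        ≈⟨ FA.coeff-sumBelow N (λ m → ĉ (wₘ m) B.* (OB.pow θ m B.* Z)) (row k) ⟨
      OB.sumBelow N (λ m → ĉ (wₘ m) B.* (OB.pow θ m B.* Z)) (row k)
        ≈⟨ columnSum (row k) ⟩
      shiftedProduct j n P θ (row k) ∎
      where
      open import Relation.Binary.Reasoning.Setoid A.setoid
      ĉ = OA.constT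
      wₘ : ℕ → PolyT
      wₘ m = constT (W₁ (- d) m j)
      Z = OB.pow (B.- θ B.+ ĉ XT) n B.* toSeries P
      columnSum : OB.sumBelow N (λ m → ĉ (wₘ m) B.* (OB.pow θ m B.* Z)) B.≈ shiftedProduct j n P θ
      columnSum = B.trans (ΣB.sumBelow-cong N (λ m → B.sym (B.*-assoc (ĉ (wₘ m)) (OB.pow θ m) Z)))
        (B.trans (B.sym (ΣB.*-distribʳ-sumBelow N Z (λ m → ĉ (wₘ m) B.* OB.pow θ m)))
          (B.*-cong (W₁-columnSum (- d) j N j<N) (B.*-congˡ {OB.pow (B.- θ B.+ ĉ XT) n} (B.sym (evalAt-θ P)))))

    triple≤-as-rowSum : ∀ i j n P N → j < N →
      triple≤ N (W₁ d) (𝔐 q P n XT) (W₁ (- d)) i j ≈T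
      OA.sumBelow N (λ k → constT (W₁ d i k) A.* shiftedProduct j n P θ (row k))
    triple≤-as-rowSum i j n P N j<N =
      A.trans (sumBelowT≈ N _) (ΣA.sumBelow-cong N λ k → A.trans (sumBelowT≈ N _)
        (A.trans (A.sym (ΣA.*-distribˡ-sumBelow N (constT (W₁ d i k)) (λ m → 𝔐 q P n XT k m A.* constT (W₁ (- d) m j))))
                 (A.*-congˡ {constT (W₁ d i k)} (columnSum-as-coeff k j n P N j<N))))

    conjugation : ∀ i j n P N → j ℕ.+ n ℕ.+ length P < N →
      𝔐 q (μ d P) n (XT +T constT (- d)) i j ≈T triple≤ N (W₁ d) (𝔐 q P n XT) (W₁ (- d)) i j
    conjugation i j n P N bound = begin
      𝔐 q (μ d P) n (XT +T constT (- d)) i j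
        ≈⟨ 𝔐-μ-as-coeff i j n P ⟩
      shiftedProduct j n P Y (row i)
        ≈⟨ rowShifts-shiftedProduct i N j n P bound ⟨
      OA.sumBelow N (λ k → constT (W₁ d i k) A.* shiftedProduct j n P θ (row k))
        ≈⟨ triple≤-as-rowSum i j n P N j<N ⟨
      triple≤ N (W₁ d) (𝔐 q P n XT) (W₁ (- d)) i j ∎
      where
      open import Relation.Binary.Reasoning.Setoid A.setoid
      j<N : j < N
      j<N = ℕP.≤-<-trans (ℕP.≤-trans (ℕP.m≤m+n j n) (ℕP.m≤m+n (j ℕ.+ n) (length P))) bound

module FiniteField {c ℓ} (R : CommutativeRing c ℓ) (isField : IsField R) {q : ℕ} (card : HasCard R q) where
  open CommutativeRing R hiding (zero)
  open Ops R
  open Powers R using (pow-1#; pow-cong; pow-distrib-*; fromℕ-^)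
  open Inverse card using (to; from; to-cong; from-cong; inverseˡ; inverseʳ)
  import Algebra.Properties.CommutativeMonoid.Sum as CommutativeMonoidSum
  private
    module Sum = CommutativeMonoidSum +-commutativeMonoid
    module Product = CommutativeMonoidSum *-commutativeMonoid
  open import Relation.Binary.Reasoning.Setoid setoid

  1≉0 : ¬ (1# ≈ 0#)
  1≉0 = proj₁ isField

  inverse : ∀ x → ¬ (x ≈ 0#) → ∃ λ y → x * y ≈ 1#
  inverse = proj₂ isField

  from∘to : ∀ x → from (to x) ≈ x
  from∘to x = inverseʳ ≡.refl

  to∘from : ∀ i → to (from i) ≡ i
  to∘from i = inverseˡ refl

  _≈?_ : ∀ x y → Dec (x ≈ y)
  x ≈? y = map′ (λ tx≡ty → trans (sym (from∘to x)) (trans (from-cong tx≡ty) (from∘to y))) to-cong (to x FinP.≟ to y)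

  *-nonzero : ∀ {a b} → ¬ (a ≈ 0#) → ¬ (b ≈ 0#) → ¬ (a * b ≈ 0#)
  *-nonzero {a} {b} a≉0 b≉0 ab≈0 with inverse a a≉0
  ... | a⁻¹ , aa⁻¹≈1 = b≉0 (begin
    b                ≈⟨ *-identityˡ b ⟨
    1# * b           ≈⟨ *-congʳ (trans (sym aa⁻¹≈1) (*-comm a a⁻¹)) ⟩
    (a⁻¹ * a) * b    ≈⟨ *-assoc a⁻¹ a b ⟩
    a⁻¹ * (a * b)    ≈⟨ *-congˡ ab≈0 ⟩
    a⁻¹ * 0#         ≈⟨ zeroʳ a⁻¹ ⟩
    0#               ∎)

  permutation : (σ σ⁻¹ : Carrier → Carrier) → (∀ {x y} → x ≈ y → σ x ≈ σ y) → (∀ {x y} → x ≈ y → σ⁻¹ x ≈ σ⁻¹ y) →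
                (∀ x → σ (σ⁻¹ x) ≈ x) → (∀ x → σ⁻¹ (σ x) ≈ x) → Permutation q q
  permutation σ σ⁻¹ σ-cong σ⁻¹-cong σσ⁻¹ σ⁻¹σ = mk↔ₛ′ (λ i → to (σ (from i))) (λ i → to (σ⁻¹ (from i)))
    (λ i → ≡.trans (to-cong (σ-cong (from∘to _))) (≡.trans (to-cong (σσ⁻¹ (from i))) (to∘from i)))
    (λ i → ≡.trans (to-cong (σ⁻¹-cong (from∘to _))) (≡.trans (to-cong (σ⁻¹σ (from i))) (to∘from i)))

  -- Translation by 1 permutes R, so the sum S of all elements satisfies S = S + q · 1.
  fromℕ-card≈0 : fromℕ q ≈ 0#
  fromℕ-card≈0 = begin
    fromℕ q                  ≈⟨ +-identityˡ _ ⟨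
    0# + fromℕ q             ≈⟨ +-congʳ (-‿inverseˡ S) ⟨
    (- S + S) + fromℕ q      ≈⟨ +-assoc _ _ _ ⟩
    - S + (S + fromℕ q)      ≈⟨ +-congˡ S≈S+q ⟨
    - S + S                  ≈⟨ -‿inverseˡ S ⟩
    0#                       ∎
    where
    S = Sum.sum {q} from
    translation = permutation (_+ 1#) (_+ - 1#) +-congʳ +-congʳ
      (λ x → trans (+-assoc x _ _) (trans (+-congˡ (-‿inverseˡ 1#)) (+-identityʳ x)))
      (λ x → trans (+-assoc x _ _) (trans (+-congˡ (-‿inverseʳ 1#)) (+-identityʳ x)))
    sum-ones : ∀ n → Sum.sum {n} (λ _ → 1#) ≈ fromℕ n
    sum-ones ℕ.zero = refl
    sum-ones (suc n) = +-congˡ (sum-ones n)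
    S≈S+q : S ≈ S + fromℕ q
    S≈S+q = trans (Sum.sum-permute from translation) (trans (Sum.sum-cong-≋ (λ i → from∘to (from i + 1#)))
              (trans (Sum.∑-distrib-+ from (λ _ → 1#)) (+-congˡ (sum-ones q))))

  fromℕ-prime≈0 : ∀ p k → q ≡ p ℕ.^ k → fromℕ p ≈ 0#
  fromℕ-prime≈0 p k q≡p^k with fromℕ p ≈? 0#
  ... | yes p≈0 = p≈0
  ... | no p≉0 with inverse (fromℕ p) p≉0
  ...   | y , py≈1 = ⊥-elim (1≉0 (begin
    1#                        ≈⟨ pow-1# k ⟨
    pow 1# k                  ≈⟨ pow-cong k py≈1 ⟨
    pow (fromℕ p * y) k       ≈⟨ pow-distrib-* _ _ k ⟩
    pow (fromℕ p) k * pow y k ≈⟨ *-congʳ (fromℕ-^ p k) ⟨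
    fromℕ (p ℕ.^ k) * pow y k ≈⟨ *-congʳ (≡.subst (λ n → fromℕ n ≈ 0#) q≡p^k fromℕ-card≈0) ⟩
    0# * pow y k              ≈⟨ zeroˡ _ ⟩
    0#                        ∎))

  product-const : ∀ n x → Product.sum {n} (λ _ → x) ≈ pow x n
  product-const ℕ.zero x = refl
  product-const (suc n) x = *-congˡ (product-const n x)

  product-ones : ∀ {n} (f : Fin n → Carrier) → (∀ i → f i ≈ 1#) → Product.sum f ≈ 1#
  product-ones {ℕ.zero} f f≈1 = refl
  product-ones {suc n} f f≈1 = trans (*-cong (f≈1 Fin.zero) (product-ones (f ∘ Fin.suc) (f≈1 ∘ Fin.suc))) (*-identityˡ 1#)

  product-single : ∀ {n} (f : Fin n → Carrier) i₀ → (∀ i → i ≢ i₀ → f i ≈ 1#) → Product.sum f ≈ f i₀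
  product-single {suc n} f Fin.zero f≈1 =
    trans (*-congˡ (product-ones (f ∘ Fin.suc) (λ i → f≈1 (Fin.suc i) λ ()))) (*-identityʳ _)
  product-single {suc n} f (Fin.suc i₀) f≈1 = trans (*-congʳ (f≈1 Fin.zero λ ())) (trans (*-identityˡ _)
    (product-single (f ∘ Fin.suc) i₀ (λ i i≢i₀ → f≈1 (Fin.suc i) (i≢i₀ ∘ FinP.suc-injective))))

  product-nonzero : ∀ {n} (f : Fin n → Carrier) → (∀ i → ¬ (f i ≈ 0#)) → ¬ (Product.sum f ≈ 0#)
  product-nonzero {ℕ.zero} f _ = 1≉0
  product-nonzero {suc n} f f≉0 = *-nonzero (f≉0 Fin.zero) (product-nonzero (f ∘ Fin.suc) (f≉0 ∘ Fin.suc))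

  *-cancelʳ-nonzero : ∀ {a b c} → ¬ (c ≈ 0#) → a * c ≈ b * c → a ≈ b
  *-cancelʳ-nonzero {a} {b} {c} c≉0 ac≈bc with inverse c c≉0
  ... | c⁻¹ , cc⁻¹≈1 = begin
    a                  ≈⟨ *-identityʳ a ⟨
    a * 1#             ≈⟨ *-congˡ cc⁻¹≈1 ⟨
    a * (c * c⁻¹)      ≈⟨ *-assoc a c c⁻¹ ⟨
    (a * c) * c⁻¹      ≈⟨ *-congʳ ac≈bc ⟩
    (b * c) * c⁻¹      ≈⟨ *-assoc b c c⁻¹ ⟩
    b * (c * c⁻¹)      ≈⟨ *-congˡ cc⁻¹≈1 ⟩
    b * 1#             ≈⟨ *-identityʳ b ⟩
    b                  ∎

  -- x ↦ d x permutes R; with 0 replaced by 1, the product A of all elements is nonzero and A d = d^q A.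
  private
    module Dilation (d : Carrier) (d≉0 : ¬ (d ≈ 0#)) where
      unzero : Carrier → Carrier
      unzero x with x ≈? 0#
      ... | yes _ = 1#
      ... | no _ = x

      correction : Carrier → Carrier
      correction x with x ≈? 0#
      ... | yes _ = d
      ... | no _ = 1#

      unzero-nonzero : ∀ x → ¬ (unzero x ≈ 0#)
      unzero-nonzero x with x ≈? 0#
      ... | yes _ = 1≉0
      ... | no x≉0 = x≉0

      unzero-cong : ∀ {x y} → x ≈ y → unzero x ≈ unzero y
      unzero-cong {x} {y} x≈y with x ≈? 0# | y ≈? 0#
      ... | yes _ | yes _ = refl
      ... | yes x≈0 | no y≉0 = ⊥-elim (y≉0 (trans (sym x≈y) x≈0))
      ... | no x≉0 | yes y≈0 = ⊥-elim (x≉0 (trans x≈y y≈0))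
      ... | no _ | no _ = x≈y

      correction-zero : ∀ x → x ≈ 0# → correction x ≈ d
      correction-zero x x≈0 with x ≈? 0#
      ... | yes _ = refl
      ... | no x≉0 = ⊥-elim (x≉0 x≈0)

      correction-nonzero : ∀ x → ¬ (x ≈ 0#) → correction x ≈ 1#
      correction-nonzero x x≉0 with x ≈? 0#
      ... | yes x≈0 = ⊥-elim (x≉0 x≈0)
      ... | no _ = refl

      scaling : ∀ x → unzero (d * x) * correction x ≈ d * unzero x
      scaling x with x ≈? 0# | (d * x) ≈? 0#
      ... | yes _ | yes _ = trans (*-identityˡ d) (sym (*-identityʳ d))
      ... | yes x≈0 | no dx≉0 = ⊥-elim (dx≉0 (trans (*-congˡ x≈0) (zeroʳ d)))
      ... | no x≉0 | yes dx≈0 = ⊥-elim (*-nonzero d≉0 x≉0 dx≈0)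
      ... | no _ | no _ = *-identityʳ _

      A : Carrier
      A = Product.sum (λ i → unzero (from i))

      A≉0 : ¬ (A ≈ 0#)
      A≉0 = product-nonzero (λ i → unzero (from i)) (λ i → unzero-nonzero (from i))

      product-correction : Product.sum (λ i → correction (from i)) ≈ d
      product-correction = trans
        (product-single (λ i → correction (from i)) (to 0#)
          (λ i i≢0 → correction-nonzero (from i) λ from-i≈0 → i≢0 (≡.trans (≡.sym (to∘from i)) (to-cong from-i≈0))))
        (correction-zero (from (to 0#)) (from∘to 0#))

      A*d≈d^q*A : A * d ≈ pow d q * A
      A*d≈d^q*A with inverse d d≉0
      ... | d⁻¹ , dd⁻¹≈1 = begin
        A * d
          ≈⟨ *-cong (trans (Product.sum-permute _ dilation) (Product.sum-cong-≋ (λ i → unzero-cong (from∘to (d * from i)))))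
                    (sym product-correction) ⟩
        Product.sum (λ i → unzero (d * from i)) * Product.sum (λ i → correction (from i))
          ≈⟨ Product.∑-distrib-+ {q} (λ i → unzero (d * from i)) (λ i → correction (from i)) ⟨
        Product.sum (λ i → unzero (d * from i) * correction (from i))
          ≈⟨ Product.sum-cong-≋ (λ i → scaling (from i)) ⟩
        Product.sum (λ i → d * unzero (from i))
          ≈⟨ Product.∑-distrib-+ (λ _ → d) (λ i → unzero (from i)) ⟩
        Product.sum {q} (λ _ → d) * A
          ≈⟨ *-congʳ (product-const q d) ⟩
        pow d q * A ∎
        where
        dilation : Permutation q q
        dilation = permutation (d *_) (d⁻¹ *_) *-congˡ *-congˡ
          (λ x → trans (sym (*-assoc d d⁻¹ x)) (trans (*-congʳ dd⁻¹≈1) (*-identityˡ x)))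
          (λ x → trans (sym (*-assoc d⁻¹ d x)) (trans (*-congʳ (trans (*-comm d⁻¹ d) dd⁻¹≈1)) (*-identityˡ x)))

  pow-card : ∀ d → pow d q ≈ d
  pow-card d with d ≈? 0#
  ... | yes d≈0 = trans (pow-cong q d≈0) (trans (pow-0# (ℕP.≤-<-trans z≤n (FinP.toℕ<n (to 0#)))) (sym d≈0))
    where
    pow-0# : ∀ {n} → 0 < n → pow 0# n ≈ 0#
    pow-0# {suc n} _ = zeroˡ _
  ... | no d≉0 = sym (*-cancelʳ-nonzero A≉0 (trans (*-comm d A) A*d≈d^q*A))
    where open Dilation d d≉0

proposition5p1p2 : ∀ {c ℓ} (R : CommutativeRing c ℓ) → IsField R →
    (q : ℕ) → IsPrimePower q → HasCard R q →
    (n : ℕ) → 1 ≤ n → (d : CommutativeRing.Carrier R) (P : Ops.PolyΘ R) →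
    let open CommutativeRing R
        open Ops R
    in ∀ i j → ∃ λ N₀ → ∀ N → N₀ ≤ N →
       𝔐 q (μ d P) n (XT +T constT (- d)) i j
         ≈T triple≤ N (W₁ d) (𝔐 q P n XT) (W₁ (- d)) i j
proposition5p1p2 R _ zero _ card _ _ _ _ _ _ = ⊥-elim (FinP.¬Fin0 (Inverse.to card (CommutativeRing.0# R)))
proposition5p1p2 R isField (suc q′) (p , k , p-prime , _ , q≡p^k) card n _ d P i j =
  suc (j ℕ.+ n ℕ.+ length P) , λ N bound → conjugation i j n P N bound
  where
  open FiniteField R isField card
  open Matrices R q′
  open Conjugation d (θ+d-frobenius k p-prime q≡p^k (fromℕ-prime≈0 p k q≡p^k) d (pow-card d))
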